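{- Let $\mathcal{R}$ be a species of non-trivial 01-networks which is closed under series composition and decomposition, and let $\mathcal{S}$ denote the species of $s$-networks in $\mathcal{R}$. Then $$\mathcal{S}=(\mathcal{R}-\mathcal{S})\cdot_s\mathcal{R},$$ the series composition being canonical, and also $$\mathcal{S}=\frac{X\mathcal{R}^2}{1+X\mathcal{R}}.$$
   Context: All graphs are finite and simple. A species is a class of labelled structures closed under relabelling along bijections; $X$ denotes the species of singletons, and sums, products, quotients like $\frac{X\mathcal{R}^2}{1+X\mathcal{R}}=\sum_{k\ge1}(-1)^{k-1}X^k\mathcal{R}^{k+1}$ (interpreted as a species identity) are the usual species operations. A 01-network (network) is a connected graph $N$ with two distinguished vertices $0$ and $1$ (the poles) such that $N\cup 01$ (the graph $N$ with the edge $01$ added if absent) is 2-connected (where $K_2$ counts as 2-connected); its underlying set is its set of internal (non-pole) vertices. The trivial network consists of the two poles and no edges; a network is non-trivial otherwise. Series composition: for disjoint non-trivial networks $M,N$, $M\cdot_s N$ is the network obtained from the union of $M$ and $N$ by identifying the pole $1$ of $M$ with the pole $0$ of $N$; this connecting vertex is labelled by an extra element of the underlying set and is distinguished (so as species $\mathcal{M}\cdot_s\mathcal{N}=\mathcal{M}X\mathcal{N}$). The underlying unrooted network of a series composition is called an $s$-network. For species $\mathcal{M},\mathcal{N}$ of non-trivial networks, $\mathcal{M}\cdot_s\mathcal{N}$ is the species of all $M\cdot_sN$ with $M\in\mathcal{M}$, $N\in\mathcal{N}$. It is called canonical if for each resulting network the factors $M$ and $N$ are uniquely determined (so the rooting at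 the connecting vertex can be neglected). A species $\mathcal{R}$ of networks is closed under series composition and decomposition if for every $s$-network $R$, $R\in\mathcal{R}$ if and only if each individual factor of $R$ is in $\mathcal{R}$. -}

module Defs where

open import Data.Nat using (ℕ; zero; suc; _+_)
open import Data.Bool using (Bool; true; false; _∨_; _∧_; if_then_else_)
open import Data.Fin using (Fin; _≟_)
open import Data.Fin.Subset using (Subset)
open import Data.Fin.Permutation using (Permutation′; _⟨$⟩ʳ_; _⟨$⟩ˡ_)
open import Data.Vec using (lookup; tabulate)
open import Data.List using (List; []; _∷_; length; map)
open import Data.List.Relation.Binary.Pointwise using (Pointwise)
open import Data.List.Relation.Unary.All using (All)
open import Data.Product using (Σ; ∃; _×_; _,_; proj₁; proj₂)
open import Data.Sum using (_⊎_; inj₁; inj₂)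
open import Data.Unit using (⊤)
open import Data.Empty using (⊥)
open import Relation.Nullary using (¬_; does)
open import Relation.Binary.PropositionalEquality using (_≡_)
open import Function.Bundles using (_↔_; Inverse; _⇔_)

-- A (labelled) 01-network whose underlying set (set of internal
-- vertices) is a subset A of Fin n is represented by the pair (A , G)
-- where G : Graph n is a Boolean adjacency relation on the vertex type
-- V n = {pole 0, pole 1} ⊎ Fin n; only the poles and the internal
-- vertices in A are vertices of the network ("active" vertices).

data V (n : ℕ) : Set where
  p0  : V n
  p1  : V n
  int : Fin n → V n

Graph : ℕ → Set
Graph n = V n → V n → Bool

mem : ∀ {n} → Subset n → Fin n → Bool
mem A i = lookup A i

ind : Bool → ℕ
ind true  = 1
ind false = 0

Active : ∀ {n} → Subset n → V n → Set
Active A p0      = ⊤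
Active A p1      = ⊤
Active A (int i) = mem A i ≡ true

Edge : ∀ {n} → Graph n → V n → V n → Set
Edge G u v = G u v ≡ true

data Reach {n : ℕ} (P : V n → Set) (G : Graph n) : V n → V n → Set where
  here : ∀ {u} → Reach P G u u
  step : ∀ {u w v} → Edge G u w → P w → Reach P G w v → Reach P G u v

ConnectedOn : ∀ {n} → (V n → Set) → Graph n → Set
ConnectedOn P G = ∀ u v → P u → P v → Reach P G u v

-- 2-connectedness of a graph with vertex set given by P (which here
-- always contains the two poles, so has at least 2 vertices):
-- connected, and still connected after deleting any single vertex.
-- (For 2 vertices this is exactly K₂; for ≥ 3 vertices it is the usual
-- notion "connected without cut vertex".)
TwoConnectedOn : ∀ {n} → (V n → Set) → Graph n → Set
TwoConnectedOn P G =
  ConnectedOn P G × (∀ x → P x → ConnectedOn (λ y → P y × ¬ (y ≡ x)) G)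

isPolePair : ∀ {n} → V n → V n → Bool
isPolePair p0 p1 = true
isPolePair p1 p0 = true
isPolePair _  _  = false

add01 : ∀ {n} → Graph n → Graph n
add01 G u v = G u v ∨ isPolePair u v

IsNetwork : ∀ {n} → Subset n → Graph n → Set
IsNetwork A G =
  (∀ u v → G u v ≡ G v u) ×
  (∀ u → G u u ≡ false) ×
  (∀ u v → Edge G u v → Active A u × Active A v) ×
  ConnectedOn (Active A) G ×
  TwoConnectedOn (Active A) (add01 G)

IsTrivial : ∀ {n} → Subset n → Graph n → Set
IsTrivial A G = (∀ i → mem A i ≡ false) × (∀ u v → G u v ≡ false)

NonTrivialNetwork : ∀ {n} → Subset n → Graph n → Set
NonTrivialNetwork A G = IsNetwork A G × ¬ IsTrivial A G

Lab : ∀ {n} → Subset n → Set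
Lab {n} A = Σ (Fin n) (λ i → mem A i ≡ true)

liftV : ∀ {n m} {A : Subset n} {B : Subset m} → Lab A ↔ Lab B →
        (u : V n) → Active A u → V m
liftV e p0      _ = p0
liftV e p1      _ = p1
liftV e (int i) a = int (proj₁ (Inverse.to e (i , a)))

IsRelabelling : ∀ {n m} (A : Subset n) (G : Graph n) (B : Subset m) (H : Graph m) →
                Lab A ↔ Lab B → Set
IsRelabelling A G B H e =
  (∀ u v (a : Active A u) (b : Active A v) → G u v ≡ H (liftV {A = A} {B = B} e u a) (liftV {A = A} {B = B} e v b)) ×
  (∀ u v → Edge H u v → Active B u × Active B v)

NetSpecies : Set₁
NetSpecies = (n : ℕ) → Subset n → Graph n → Set

IsSpeciesOfNonTrivialNetworks : NetSpecies → Set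
IsSpeciesOfNonTrivialNetworks ℛ =
  (∀ n A G → ℛ n A G → NonTrivialNetwork A G) ×
  (∀ n m (A : Subset n) (G : Graph n) (B : Subset m) (H : Graph m)
     (e : Lab A ↔ Lab B) → IsRelabelling A G B H e → ℛ n A G → ℛ m B H)

eqF : ∀ {n} → Fin n → Fin n → Bool
eqF i j = does (i ≟ j)

-- The underlying set U is split as {c} ⊎ A ⊎ B (c the connecting vertex,
-- A the underlying set of the first factor, B that of the second).
IsSplit : ∀ {n} → Subset n → Fin n → Subset n → Subset n → Set
IsSplit U c A B = ∀ i → ind (eqF i c) + ind (mem A i) + ind (mem B i) ≡ ind (mem U i)

embM : ∀ {n} → Fin n → V n → V n
embM c p0      = p0
embM c p1      = int c
embM c (int i) = int i

embN : ∀ {n} → Fin n → V n → V n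
embN c p0      = int c
embN c p1      = p1
embN c (int i) = int i

IsSeriesComp : ∀ {n} → Fin n → Graph n → Graph n → Graph n → Set
IsSeriesComp c M N G = ∀ u v →
  Edge G u v ⇔
    ((∃ λ a → ∃ λ b → embM c a ≡ u × embM c b ≡ v × Edge M a b) ⊎
     (∃ λ a → ∃ λ b → embN c a ≡ u × embN c b ≡ v × Edge N a b))

IsSeriesDecomposition : ∀ {n} → Subset n → Graph n →
                        Fin n → Subset n → Graph n → Subset n → Graph n → Set
IsSeriesDecomposition U G c A M B N =
  IsSplit U c A B × NonTrivialNetwork A M × NonTrivialNetwork B N ×
  IsSeriesComp c M N G

IsSNetwork : ∀ {n} → Subset n → Graph n → Set
IsSNetwork {n} U G =
  ∃ λ (c : Fin n) → ∃ λ (A : Subset n) → ∃ λ (M : Graph n) →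
  ∃ λ (B : Subset n) → ∃ λ (N : Graph n) → IsSeriesDecomposition U G c A M B N

ClosedUnderSeries : NetSpecies → Set
ClosedUnderSeries ℛ = ∀ n (U : Subset n) (G : Graph n) c A M B N →
  IsSeriesDecomposition U G c A M B N →
  (ℛ n U G ⇔ (ℛ n A M × ℛ n B N))

SNets : NetSpecies → NetSpecies
SNets ℛ n U G = ℛ n U G × IsSNetwork U G

full : ∀ {n} → Subset n
full = tabulate (λ _ → true)

GraphEq : ∀ {n} → Graph n → Graph n → Set
GraphEq G H = ∀ u v → G u v ≡ H u v

NetEq : ∀ {n} → Subset n × Graph n → Subset n × Graph n → Set
NetEq (A , G) (B , H) = A ≡ B × GraphEq G H

-- raw structures of X^k ℛ^(k+1) on Fin n: an ordered list of k
-- singleton labels (the X-factors) and an ordered list of k+1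
-- labelled networks (the ℛ-factors)
record Chain (n : ℕ) : Set where
  constructor chain
  field
    pts    : List (Fin n)
    blocks : List (Subset n × Graph n)
open Chain public

countB : ∀ {X : Set} → (X → Bool) → List X → ℕ
countB p []       = 0
countB p (x ∷ xs) = ind (p x) + countB p xs

occ : ∀ {n} → Fin n → Chain n → ℕ
occ i ch = countB (eqF i) (pts ch) + countB (λ b → mem (proj₁ b) i) (blocks ch)

IsXRChain : NetSpecies → (n k : ℕ) → Chain n → Set
IsXRChain ℛ n k ch =
  length (pts ch) ≡ k × length (blocks ch) ≡ suc k ×
  (∀ i → occ i ch ≡ 1) ×
  All (λ b → ℛ n (proj₁ b) (proj₂ b)) (blocks ch)

ChainEq : ∀ {n} → Chain n → Chain n → Set
ChainEq ch ch' = pts ch ≡ pts ch' × Pointwise NetEq (blocks ch) (blocks ch')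

actV : ∀ {n} → Permutation′ n → V n → V n
actV σ p0      = p0
actV σ p1      = p1
actV σ (int i) = int (σ ⟨$⟩ʳ i)

actSubset : ∀ {n} → Permutation′ n → Subset n → Subset n
actSubset σ A = tabulate (λ j → mem A (σ ⟨$⟩ˡ j))

actGraph : ∀ {n} → Permutation′ n → Graph n → Graph n
actGraph σ G u v = G (actV' u) (actV' v)
  where
  actV' : _ → _
  actV' p0      = p0
  actV' p1      = p1
  actV' (int j) = int (σ ⟨$⟩ˡ j)

actNet : ∀ {n} → Permutation′ n → Subset n × Graph n → Subset n × Graph n
actNet σ (A , G) = actSubset σ A , actGraph σ G

actChain : ∀ {n} → Permutation′ n → Chain n → Chain n
actChain σ ch = chain (map (σ ⟨$⟩ʳ_) (pts ch)) (map (actNet σ) (blocks ch))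

-- The two sides of  𝒮 + Σ_{k even ≥ 2} X^k ℛ^(k+1)  ≅  Σ_{k odd} X^k ℛ^(k+1),
-- which is the meaning of the virtual species identity
--   𝒮 = Σ_{k≥1} (-1)^(k-1) X^k ℛ^(k+1)  ( = X ℛ² / (1 + X ℛ) ).

LHS : NetSpecies → ℕ → Set
LHS ℛ n = (Σ (Graph n) (λ G → SNets ℛ n full G)) ⊎
          (Σ ℕ λ m → Σ (Chain n) (IsXRChain ℛ n (suc (suc (m + m)))))

RHS : NetSpecies → ℕ → Set
RHS ℛ n = Σ ℕ λ m → Σ (Chain n) (IsXRChain ℛ n (suc (m + m)))

RawL : ℕ → Set
RawL n = Graph n ⊎ Chain n

rawL : ∀ {n} (ℛ : NetSpecies) → LHS ℛ n → RawL n
rawL _ (inj₁ (G , _))      = inj₁ G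
rawL _ (inj₂ (_ , ch , _)) = inj₂ ch

rawR : ∀ {n} (ℛ : NetSpecies) → RHS ℛ n → Chain n
rawR _ (_ , ch , _) = ch

RawLEq : ∀ {n} → RawL n → RawL n → Set
RawLEq (inj₁ G) (inj₁ H)   = GraphEq G H
RawLEq (inj₂ c) (inj₂ c')  = ChainEq c c'
RawLEq _        _          = ⊥

actRawL : ∀ {n} → Permutation′ n → RawL n → RawL n
actRawL σ (inj₁ G)  = inj₁ (actGraph σ G)
actRawL σ (inj₂ ch) = inj₂ (actChain σ ch)

-- a natural isomorphism of species LHS ≅ RHS (structures compared up to
-- equality of their data, ignoring proofs)
record NatIso (ℛ : NetSpecies) : Set where
  field
    f : ∀ {n} → LHS ℛ n → RHS ℛ n
    g : ∀ {n} → RHS ℛ n → LHS ℛ n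
    f-cong : ∀ {n} (x y : LHS ℛ n) → RawLEq (rawL ℛ x) (rawL ℛ y) → ChainEq (rawR ℛ (f x)) (rawR ℛ (f y))
    g-cong : ∀ {n} (x y : RHS ℛ n) → ChainEq (rawR ℛ x) (rawR ℛ y) → RawLEq (rawL ℛ (g x)) (rawL ℛ (g y))
    gf : ∀ {n} (x : LHS ℛ n) → RawLEq (rawL ℛ (g (f x))) (rawL ℛ x)
    fg : ∀ {n} (y : RHS ℛ n) → ChainEq (rawR ℛ (f (g y))) (rawR ℛ y)
    natural : ∀ {n} (σ : Permutation′ n) (x x' : LHS ℛ n) →
      RawLEq (rawL ℛ x') (actRawL σ (rawL ℛ x)) →
      ChainEq (rawR ℛ (f x')) (actChain σ (rawR ℛ (f x)))

Minus : NetSpecies → NetSpecies → NetSpecies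
Minus ℛ 𝒮 n A M = ℛ n A M × ¬ 𝒮 n A M

IsSeriesProductOf : NetSpecies → NetSpecies → (n : ℕ) →
  Graph n → Fin n → Subset n → Graph n → Subset n → Graph n → Set
IsSeriesProductOf ℳ 𝒩 n G c A M B N =
  IsSplit full c A B × ℳ n A M × 𝒩 n B N × IsSeriesComp c M N G

InSeriesProduct : NetSpecies → NetSpecies → NetSpecies
InSeriesProduct ℳ 𝒩 n U G =
  ∃ λ c → ∃ λ A → ∃ λ M → ∃ λ B → ∃ λ N → IsSeriesProductOf ℳ 𝒩 n G c A M B N

IsCanonical : NetSpecies → NetSpecies → Set
IsCanonical ℳ 𝒩 = ∀ n G c A M B N c' A' M' B' N' →
  IsSeriesProductOf ℳ 𝒩 n G c A M B N →
  IsSeriesProductOf ℳ 𝒩 n G c' A' M' B' N' →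
  c ≡ c' × NetEq (A , M) (A' , M') × NetEq (B , N) (B' , N')

module Submission where

-- A network H is an s-network iff some internal vertex c separates it: the internal vertices split into a
-- side A next to pole 0 and a side next to pole 1 with no edge across, and the two factors are then the
-- subnetworks induced on A ∪ {0, c} and on the other side ∪ {c, 1}. Among all such cuts there is a unique
-- one whose first factor is not itself an s-network (the cut vertex closest to pole 0): two distinct cut
-- vertices lie in each other's factors, and the nearer one cuts the first factor of the farther one. This
-- gives the canonical decomposition 𝒮 = (ℛ − 𝒮) ·ₛ ℛ, using closure of ℛ under series (de)composition.
-- The identity 𝒮 = Xℛ²/(1 + Xℛ) is a sign-reversing involution on chains R₀ x₁ R₁ … xₖ Rₖ: if R₀ is an
-- s-network split it canonically, otherwise join R₀ and R₁ at x₁; both moves change k by one, they are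
-- mutually inverse by uniqueness of the canonical decomposition, and they commute with relabelling.

open import Data.Bool using (Bool; true; false; _∨_; _∧_; not; if_then_else_)
open import Data.Bool.Properties using (⇔→≡)
import Data.Bool.Properties as BP
open import Data.Empty using (⊥; ⊥-elim)
open import Data.Fin as F using (Fin)
import Data.Fin.Properties as FP
open import Data.Fin.Permutation as P using (Permutation′; _⟨$⟩ʳ_; _⟨$⟩ˡ_)
open import Data.Fin.Subset using (Subset; _∈_; _⊂_; ∣_∣)
open import Data.Fin.Subset.Properties using (anySubset?; p⊂q⇒∣p∣<∣q∣)
open import Data.List using (List; []; _∷_; map)
import Data.List.Properties as LP
open import Data.List.Relation.Binary.Pointwise as Pw using (Pointwise; []; _∷_)
open import Data.List.Relation.Unary.All as All using (All; _∷_)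
open import Data.Nat using (ℕ; zero; suc; _+_; _≤_; _<_; z≤n; s≤s)
import Data.Nat.Properties as ℕP
open import Data.Nat.Solver using (module +-*-Solver)
open import Data.Product using (Σ; ∃; _×_; _,_; proj₁; proj₂)
open import Data.Sum using (_⊎_; inj₁; inj₂)
open import Data.Unit using (⊤; tt)
open import Data.Vec using (Vec; lookup; tabulate)
import Data.Vec.Properties as VP
open import Function.Bundles using (_⇔_; mk⇔; Equivalence)
open import Relation.Binary.PropositionalEquality using (_≡_; refl; sym; trans; cong; cong₂; subst)
open import Relation.Nullary using (¬_; Dec; yes; no)
open import Relation.Nullary.Decidable using (_×-dec_; _→-dec_; dec-true; dec-false)

open import Defs
open +-*-Solver using (solve; _:+_; _:=_)

int-injective : ∀ {n} {i j : Fin n} → int i ≡ int j → i ≡ j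
int-injective refl = refl

true≢false : true ≡ false → ⊥
true≢false ()

∧-elimˡ : ∀ {a b} → (a ∧ b) ≡ true → a ≡ true
∧-elimˡ {true} e = refl

∧-elimʳ : ∀ {a b} → (a ∧ b) ≡ true → b ≡ true
∧-elimʳ {true} e = e

∧-intro : ∀ {a b} → a ≡ true → b ≡ true → (a ∧ b) ≡ true
∧-intro refl refl = refl

∨-elim : ∀ {a b} → (a ∨ b) ≡ true → a ≡ true ⊎ b ≡ true
∨-elim {true} e = inj₁ refl
∨-elim {false} e = inj₂ e

∨-introˡ : ∀ {a b} → a ≡ true → (a ∨ b) ≡ true
∨-introˡ refl = refl

∨-introʳ : ∀ {a b} → b ≡ true → (a ∨ b) ≡ true
∨-introʳ {true} e = refl
∨-introʳ {false} e = e

not≡true⇒≡false : ∀ {a} → not a ≡ true → a ≡ false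
not≡true⇒≡false {false} e = refl

≡false⇒not≡true : ∀ {a} → a ≡ false → not a ≡ true
≡false⇒not≡true refl = refl

≡false⇒≢true : ∀ {a} → a ≡ false → a ≡ true → ⊥
≡false⇒≢true refl ()

≢true⇒≡false : ∀ {a} → (a ≡ true → ⊥) → a ≡ false
≢true⇒≡false {false} _ = refl
≢true⇒≡false {true} h = ⊥-elim (h refl)

≡true-ext : ∀ {a b} → (a ≡ true → b ≡ true) → (b ≡ true → a ≡ true) → a ≡ b
≡true-ext f g = ⇔→≡ (mk⇔ f g)

eqF-diag : ∀ {n} (i : Fin n) → eqF i i ≡ true
eqF-diag i = dec-true (i F.≟ i) refl

≢⇒eqF≡false : ∀ {n} {i j : Fin n} → ¬ i ≡ j → eqF i j ≡ false
≢⇒eqF≡false {i = i} {j} = dec-false (i F.≟ j)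

eqF⇒≡ : ∀ {n} {i j : Fin n} → eqF i j ≡ true → i ≡ j
eqF⇒≡ {i = i} {j} e with i F.≟ j
... | yes p = p
eqF⇒≡ {i = i} {j} () | no _

all-V? : ∀ {n} {P : V n → Set} → (∀ v → Dec (P v)) → Dec (∀ v → P v)
all-V? {P = P} d with d p0 | d p1 | FP.all? (λ i → d (int i))
... | no np | _ | _ = no λ h → np (h p0)
... | yes _ | no np | _ = no λ h → np (h p1)
... | yes _ | yes _ | no np = no λ h → np (λ i → h (int i))
... | yes a | yes b | yes c = yes λ { p0 → a ; p1 → b ; (int i) → c i }

lookup-ext : ∀ {n} {A : Set} {xs ys : Vec A n} → (∀ i → lookup xs i ≡ lookup ys i) → xs ≡ ys
lookup-ext {xs = xs} {ys} h = trans (sym (VP.tabulate∘lookup xs)) (trans (VP.tabulate-cong h) (VP.tabulate∘lookup ys))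

mem-tabulate : ∀ {n} (f : Fin n → Bool) i → mem (tabulate f) i ≡ f i
mem-tabulate f i = VP.lookup∘tabulate f i

ind≤1 : ∀ b → ind b ≤ 1
ind≤1 true = s≤s z≤n
ind≤1 false = z≤n

ind≡1⇒true : ∀ {b} → ind b ≡ 1 → b ≡ true
ind≡1⇒true {true} _ = refl

module SplitFacts {n} {U : Subset n} {c : Fin n} {A B : Subset n} (sp : IsSplit U c A B) where
  private
    ExactlyOneOf : (a b d u : Bool) → Set
    ExactlyOneOf a b d u =
      (a ≡ true → b ≡ false × d ≡ false × u ≡ true) ×
      (b ≡ true → a ≡ false × d ≡ false × u ≡ true) ×
      (d ≡ true → a ≡ false × b ≡ false × u ≡ true) ×
      (u ≡ true → a ≡ true ⊎ b ≡ true ⊎ d ≡ true)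

    exactly-one : ∀ (a b d u : Bool) → ind a + ind b + ind d ≡ ind u → ExactlyOneOf a b d u
    exactly-one false false false false e = (λ ()) , (λ ()) , (λ ()) , (λ ())
    exactly-one false false true true e = (λ ()) , (λ ()) , (λ _ → refl , refl , refl) , (λ _ → inj₂ (inj₂ refl))
    exactly-one false true false true e = (λ ()) , (λ _ → refl , refl , refl) , (λ ()) , (λ _ → inj₂ (inj₁ refl))
    exactly-one true false false true e = (λ _ → refl , refl , refl) , (λ ()) , (λ ()) , (λ _ → inj₁ refl)
    exactly-one false false false true ()
    exactly-one false false true false ()
    exactly-one false true false false ()
    exactly-one false true true false ()
    exactly-one false true true true ()
    exactly-one true false false false ()
    exactly-one true false true false ()
    exactly-one true false true true ()
    exactly-one true true false false ()
    exactly-one true true false true ()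
    exactly-one true true true false ()
    exactly-one true true true true ()
    split-at : ∀ i → ExactlyOneOf (eqF i c) (mem A i) (mem B i) (mem U i)
    split-at i = exactly-one (eqF i c) (mem A i) (mem B i) (mem U i) (sp i)

  c∈U : mem U c ≡ true
  c∈U = proj₂ (proj₂ (proj₁ (split-at c) (eqF-diag c)))
  c∉A : mem A c ≡ false
  c∉A = proj₁ (proj₁ (split-at c) (eqF-diag c))
  c∉B : mem B c ≡ false
  c∉B = proj₁ (proj₂ (proj₁ (split-at c) (eqF-diag c)))
  A⊆U : ∀ i → mem A i ≡ true → mem U i ≡ true
  A⊆U i a = proj₂ (proj₂ (proj₁ (proj₂ (split-at i)) a))
  A⇒¬B : ∀ i → mem A i ≡ true → mem B i ≡ false
  A⇒¬B i a = proj₁ (proj₂ (proj₁ (proj₂ (split-at i)) a))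
  A∌c : ∀ i → mem A i ≡ true → ¬ i ≡ c
  A∌c i a refl = ≡false⇒≢true c∉A a
  B∌c : ∀ i → mem B i ≡ true → ¬ i ≡ c
  B∌c i b refl = ≡false⇒≢true c∉B b
  U-cases : ∀ i → mem U i ≡ true → i ≡ c ⊎ mem A i ≡ true ⊎ mem B i ≡ true
  U-cases i u with proj₂ (proj₂ (proj₂ (split-at i))) u
  ... | inj₁ e = inj₁ (eqF⇒≡ e)
  ... | inj₂ (inj₁ a) = inj₂ (inj₁ a)
  ... | inj₂ (inj₂ b) = inj₂ (inj₂ b)

Reach-map : ∀ {n} {PH PK : V n → Set} {G K : Graph n} (π : V n → V n) →
  (∀ x → PH x → PK (π x)) →
  (∀ x y → PH x → PH y → Edge G x y → π x ≡ π y ⊎ Edge K (π x) (π y)) →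
  ∀ {x y} → PH x → Reach PH G x y → Reach PK K (π x) (π y)
Reach-map π π-pred π-edge px here = here
Reach-map {PK = PK} {K = K} π π-pred π-edge {y = y} px (step e pw r) with π-edge _ _ px pw e
... | inj₁ eq = subst (λ z → Reach PK K z (π y)) (sym eq) (Reach-map π π-pred π-edge pw r)
... | inj₂ e' = step e' (π-pred _ pw) (Reach-map π π-pred π-edge pw r)

Reach-map-onto : ∀ {n} {PH PK : V n → Set} {G K : Graph n} (π : V n → V n) →
  (∀ x → PH x → PK (π x)) →
  (∀ x y → PH x → PH y → Edge G x y → π x ≡ π y ⊎ Edge K (π x) (π y)) →
  ∀ {x y u v} → π x ≡ u → π y ≡ v → PH x → Reach PH G x y → Reach PK K u v
Reach-map-onto π π-pred π-edge refl refl = Reach-map π π-pred π-edge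

activeB : ∀ {n} → Subset n → V n → Bool
activeB A p0 = true
activeB A p1 = true
activeB A (int i) = mem A i

activeB⇒Active : ∀ {n} {A : Subset n} u → activeB A u ≡ true → Active A u
activeB⇒Active p0 _ = tt
activeB⇒Active p1 _ = tt
activeB⇒Active (int i) a = a

leftSide : ∀ {n} → Subset n → V n → Bool
leftSide A1 p0 = true
leftSide A1 p1 = false
leftSide A1 (int i) = mem A1 i

rightSide : ∀ {n} → Subset n → Fin n → Subset n → V n → Bool
rightSide U c A1 p0 = false
rightSide U c A1 p1 = true
rightSide U c A1 (int i) = mem U i ∧ not (mem A1 i) ∧ not (eqF i c)

-- A decidable description of series decompositions: the cut c splits the vertices of U into
-- leftSide A1 (pole 0 and A1) and rightSide U c A1 (pole 1 and U ∖ (A1 ∪ {c})) with no edge across.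
Separation : ∀ {n} → Subset n → Graph n → Fin n → Subset n → Set
Separation U H c A1 = mem U c ≡ true × (∀ i → mem A1 i ≡ true → mem U i ≡ true) × mem A1 c ≡ false ×
               (∀ x y → (H x y ∧ leftSide A1 x ∧ rightSide U c A1 y) ≡ false)

rightPart : ∀ {n} → Subset n → Fin n → Subset n → Subset n
rightPart U c A1 = tabulate (λ i → mem U i ∧ not (mem A1 i) ∧ not (eqF i c))

leftFactor : ∀ {n} → Fin n → Subset n → Graph n → Graph n
leftFactor c A1 H u v = activeB A1 u ∧ activeB A1 v ∧ H (embM c u) (embM c v)

rightFactor : ∀ {n} → Fin n → Subset n → Graph n → Graph n
rightFactor c B1 H u v = activeB B1 u ∧ activeB B1 v ∧ H (embN c u) (embN c v)

module NetworkFacts {n} {A : Subset n} {G : Graph n} (net : IsNetwork A G) where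
  adj-sym : ∀ u v → G u v ≡ G v u
  adj-sym = proj₁ net
  adj-irrefl : ∀ u → G u u ≡ false
  adj-irrefl = proj₁ (proj₂ net)
  edge-active : ∀ u v → Edge G u v → Active A u × Active A v
  edge-active = proj₁ (proj₂ (proj₂ net))
  connected : ConnectedOn (Active A) G
  connected = proj₁ (proj₂ (proj₂ (proj₂ net)))
  connected01 : ConnectedOn (Active A) (add01 G)
  connected01 = proj₁ (proj₂ (proj₂ (proj₂ (proj₂ net))))
  connected01-minus : ∀ x → Active A x → ConnectedOn (λ y → Active A y × ¬ (y ≡ x)) (add01 G)
  connected01-minus = proj₂ (proj₂ (proj₂ (proj₂ (proj₂ net))))
  edge-sym : ∀ {u v} → Edge G u v → Edge G v u
  edge-sym {u} {v} e = trans (adj-sym v u) e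

add01-elim : ∀ {n} {G : Graph n} {x y} → Edge (add01 G) x y → Edge G x y ⊎ isPolePair x y ≡ true
add01-elim e = ∨-elim e
add01-intro : ∀ {n} {G : Graph n} {x y} → Edge G x y → Edge (add01 G) x y
add01-intro e = ∨-introˡ e
add01-01 : ∀ {n} {G : Graph n} → Edge (add01 G) p0 p1
add01-01 = ∨-introʳ refl
add01-10 : ∀ {n} {G : Graph n} → Edge (add01 G) p1 p0
add01-10 {G = G} = ∨-introʳ {G p1 p0} refl

Reach-first-edge : ∀ {n} {P : V n → Set} {G : Graph n} {u v} → Reach P G u v → ¬ u ≡ v → ∃ λ w → Edge G u w
Reach-first-edge here ne = ⊥-elim (ne refl)
Reach-first-edge (step {w = w} e _ _) ne = w , e

connected⇒nonTrivial : ∀ {n} {A : Subset n} {G : Graph n} → ConnectedOn (Active A) G → ¬ IsTrivial A G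
connected⇒nonTrivial {A = A} {G} con (_ , noE) with Reach-first-edge (con p0 p1 tt tt) (λ ())
... | w , e = true≢false (trans (sym e) (noE p0 w))

SeriesEdge : ∀ {n} → Fin n → Graph n → Graph n → V n → V n → Set
SeriesEdge c M N u v = (∃ λ a → ∃ λ b → embM c a ≡ u × embM c b ≡ v × Edge M a b) ⊎
                       (∃ λ a → ∃ λ b → embN c a ≡ u × embN c b ≡ v × Edge N a b)

keepIf : ∀ {n} → Bool → Fin n → V n → V n
keepIf true i d = int i
keepIf false i d = d

module FactorsOfSeparation {n} {U : Subset n} {H : Graph n} (net : IsNetwork U H) {c : Fin n} {A1 : Subset n} (sep : Separation U H c A1) where
  open NetworkFacts net public
  c∈U : mem U c ≡ true
  c∈U = proj₁ sep
  A1⊆U : ∀ i → mem A1 i ≡ true → mem U i ≡ true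
  A1⊆U = proj₁ (proj₂ sep)
  c∉A1 : mem A1 c ≡ false
  c∉A1 = proj₁ (proj₂ (proj₂ sep))
  no-cross-edge : ∀ x y → (H x y ∧ leftSide A1 x ∧ rightSide U c A1 y) ≡ false
  no-cross-edge = proj₂ (proj₂ (proj₂ sep))

  B1 : Subset n
  B1 = rightPart U c A1

  data Side : V n → Set where
    onLeft : ∀ {x} → leftSide A1 x ≡ true → Side x
    atCut : Side (int c)
    onRight : ∀ {x} → rightSide U c A1 x ≡ true → Side x

  side : ∀ x → Active U x → Side x
  side p0 _ = onLeft refl
  side p1 _ = onRight refl
  side (int i) u with mem A1 i in eA | i F.≟ c
  ... | true | _ = onLeft eA
  ... | false | yes refl = atCut
  ... | false | no ne = onRight (∧-intro u (∧-intro (≡false⇒not≡true eA) (≡false⇒not≡true (≢⇒eqF≡false ne))))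

  no-edge-left-right : ∀ {x y} → Edge H x y → leftSide A1 x ≡ true → rightSide U c A1 y ≡ true → ⊥
  no-edge-left-right {x} {y} e l r = true≢false (trans (sym (∧-intro e (∧-intro l r))) (no-cross-edge x y))

  no-edge-right-left : ∀ {x y} → Edge H x y → rightSide U c A1 x ≡ true → leftSide A1 y ≡ true → ⊥
  no-edge-right-left e r l = no-edge-left-right (edge-sym e) l r

  rightSide⇒∉A1 : ∀ {i} → rightSide U c A1 (int i) ≡ true → mem A1 i ≡ false
  rightSide⇒∉A1 {i} r = not≡true⇒≡false (∧-elimˡ {not (mem A1 i)} (∧-elimʳ {mem U i} r))

  rightSide⇒≢c : ∀ {i} → rightSide U c A1 (int i) ≡ true → ¬ i ≡ c
  rightSide⇒≢c r refl = ≡false⇒≢true (not≡true⇒≡false (∧-elimʳ {not (mem A1 c)} (∧-elimʳ {mem U c} r))) (eqF-diag c)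

  rightSide⇒∈U : ∀ {i} → rightSide U c A1 (int i) ≡ true → mem U i ≡ true
  rightSide⇒∈U r = ∧-elimˡ r

  mem-B1 : ∀ i → mem B1 i ≡ rightSide U c A1 (int i)
  mem-B1 i = mem-tabulate _ i

  leftSide⇒∉B1 : ∀ {i} → leftSide A1 (int i) ≡ true → mem B1 i ≡ false
  leftSide⇒∉B1 {i} l = trans (mem-B1 i) (≢true⇒≡false λ r → ≡false⇒≢true (rightSide⇒∉A1 r) l)

  c∉B1 : mem B1 c ≡ false
  c∉B1 = trans (mem-B1 c) (≢true⇒≡false λ r → rightSide⇒≢c r refl)

  M : Graph n
  M = leftFactor c A1 H

  -- Walks of H (∪ 01) are carried onto M by collapsing the cut vertex and the right side onto pole 1.
  -- When c itself is deleted, the two sides only meet through the edge 01, so projL′ collapses the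
  -- right side onto pole 0 instead.
  projL : V n → V n
  projL p0 = p0
  projL p1 = p1
  projL (int i) = keepIf (mem A1 i) i p1

  projL′ : V n → V n
  projL′ p0 = p0
  projL′ p1 = p0
  projL′ (int i) = keepIf (mem A1 i) i p0

  LiftsToM : (V n → V n) → V n → Set
  LiftsToM π x = embM c (π x) ≡ x × activeB A1 (π x) ≡ true

  leftSide-lifts : ∀ {x} → leftSide A1 x ≡ true → LiftsToM projL x
  leftSide-lifts {p0} _ = refl , refl
  leftSide-lifts {int i} l rewrite l = refl , l

  leftSide-lifts′ : ∀ {x} → leftSide A1 x ≡ true → LiftsToM projL′ x
  leftSide-lifts′ {p0} _ = refl , refl
  leftSide-lifts′ {int i} l rewrite l = refl , l

  cut-lifts : LiftsToM projL (int c)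
  cut-lifts rewrite c∉A1 = refl , refl

  rightSide-projL : ∀ {x} → rightSide U c A1 x ≡ true → projL x ≡ p1
  rightSide-projL {p1} _ = refl
  rightSide-projL {int i} r rewrite rightSide⇒∉A1 r = refl

  rightSide-projL′ : ∀ {x} → rightSide U c A1 x ≡ true → projL′ x ≡ p0
  rightSide-projL′ {p1} _ = refl
  rightSide-projL′ {int i} r rewrite rightSide⇒∉A1 r = refl

  cut-projL : projL (int c) ≡ p1
  cut-projL rewrite c∉A1 = refl

  edge-in-M : ∀ {π : V n → V n} {x y} → LiftsToM π x → LiftsToM π y → Edge H x y → Edge M (π x) (π y)
  edge-in-M {π} {x} {y} (ex , ax) (ey , ay) e =
    ∧-intro ax (∧-intro ay (subst (λ a → H a (embM c (π y)) ≡ true) (sym ex) (subst (λ b → H x b ≡ true) (sym ey) e)))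

  projL-edge : ∀ x y → Active U x → Active U y → Edge H x y → projL x ≡ projL y ⊎ Edge M (projL x) (projL y)
  projL-edge x y ux uy e with side x ux | side y uy
  ... | onLeft lx | onLeft ly = inj₂ (edge-in-M {projL} {x} {y} (leftSide-lifts lx) (leftSide-lifts ly) e)
  projL-edge x .(int c) ux uy e | onLeft lx | atCut = inj₂ (edge-in-M {projL} {x} {int c} (leftSide-lifts lx) cut-lifts e)
  projL-edge x y ux uy e | onLeft lx | onRight ry = ⊥-elim (no-edge-left-right e lx ry)
  projL-edge .(int c) y ux uy e | atCut | onLeft ly = inj₂ (edge-in-M {projL} {int c} {y} cut-lifts (leftSide-lifts ly) e)
  projL-edge .(int c) .(int c) ux uy e | atCut | atCut = inj₁ refl
  projL-edge .(int c) y ux uy e | atCut | onRight ry = inj₁ (trans cut-projL (sym (rightSide-projL {y} ry)))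
  projL-edge x y ux uy e | onRight rx | onLeft ly = ⊥-elim (no-edge-right-left e rx ly)
  projL-edge x .(int c) ux uy e | onRight rx | atCut = inj₁ (trans (rightSide-projL {x} rx) (sym cut-projL))
  projL-edge x y ux uy e | onRight rx | onRight ry = inj₁ (trans (rightSide-projL {x} rx) (sym (rightSide-projL {y} ry)))

  projL-edge01 : ∀ x y → Active U x → Active U y → Edge (add01 H) x y → projL x ≡ projL y ⊎ Edge (add01 M) (projL x) (projL y)
  projL-edge01 x y ux uy e with add01-elim {G = H} {x} {y} e
  ... | inj₁ e' with projL-edge x y ux uy e'
  ... | inj₁ q = inj₁ q
  ... | inj₂ q = inj₂ (add01-intro {G = M} {projL x} {projL y} q)
  projL-edge01 p0 p1 ux uy e | inj₂ pp = inj₂ (add01-01 {G = M})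
  projL-edge01 p1 p0 ux uy e | inj₂ pp = inj₂ (add01-10 {G = M})

  projL′-edge01 : ∀ x y → Active U x × ¬ x ≡ int c → Active U y × ¬ y ≡ int c → Edge (add01 H) x y →
            projL′ x ≡ projL′ y ⊎ Edge (add01 M) (projL′ x) (projL′ y)
  projL′-edge01 x y (ux , nx) (uy , ny) e with add01-elim {G = H} {x} {y} e
  ... | inj₁ e' with side x ux | side y uy
  ... | onLeft lx | onLeft ly = inj₂ (add01-intro {G = M} {projL′ x} {projL′ y} (edge-in-M {projL′} {x} {y} (leftSide-lifts′ lx) (leftSide-lifts′ ly) e'))
  ... | onLeft lx | onRight ry = ⊥-elim (no-edge-left-right e' lx ry)
  ... | onRight rx | onLeft ly = ⊥-elim (no-edge-right-left e' rx ly)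
  ... | onRight rx | onRight ry = inj₁ (trans (rightSide-projL′ {x} rx) (sym (rightSide-projL′ {y} ry)))
  ... | atCut | _ = ⊥-elim (nx refl)
  ... | _ | atCut = ⊥-elim (ny refl)
  projL′-edge01 p0 p1 _ _ e | inj₂ pp = inj₁ refl
  projL′-edge01 p1 p0 _ _ e | inj₂ pp = inj₁ refl

  embM-active : ∀ u → Active A1 u → Active U (embM c u)
  embM-active p0 _ = tt
  embM-active p1 _ = c∈U
  embM-active (int i) a = A1⊆U i a

  projL-embM : ∀ u → Active A1 u → projL (embM c u) ≡ u
  projL-embM p0 _ = refl
  projL-embM p1 _ = cut-projL
  projL-embM (int i) a rewrite a = refl

  projL′-embM : ∀ u → Active A1 u → ¬ u ≡ p1 → projL′ (embM c u) ≡ u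
  projL′-embM p0 _ _ = refl
  projL′-embM p1 _ n = ⊥-elim (n refl)
  projL′-embM (int i) a _ rewrite a = refl

  projL-active : ∀ x → Active U x → Active A1 (projL x)
  projL-active p0 _ = tt
  projL-active p1 _ = tt
  projL-active (int i) _ with mem A1 i in e
  ... | true = e
  ... | false = tt

  leftFactor-connected : ConnectedOn (Active A1) M
  leftFactor-connected u v au av = Reach-map-onto projL projL-active projL-edge (projL-embM u au) (projL-embM v av)
    (embM-active u au)
    (connected (embM c u) (embM c v) (embM-active u au) (embM-active v av))

  leftFactor-connected01 : ConnectedOn (Active A1) (add01 M)
  leftFactor-connected01 u v au av = Reach-map-onto projL projL-active projL-edge01 (projL-embM u au) (projL-embM v av)
    (embM-active u au)
    (connected01 (embM c u) (embM c v) (embM-active u au) (embM-active v av))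

  leftFactor-edge⁻ : ∀ u v → Edge M u v → activeB A1 u ≡ true × activeB A1 v ≡ true × Edge H (embM c u) (embM c v)
  leftFactor-edge⁻ u v e = ∧-elimˡ {activeB A1 u} e , ∧-elimˡ {activeB A1 v} (∧-elimʳ {activeB A1 u} e) , ∧-elimʳ {activeB A1 v} (∧-elimʳ {activeB A1 u} e)

  leftFactor-edge⁺ : ∀ u v → activeB A1 u ≡ true → activeB A1 v ≡ true → Edge H (embM c u) (embM c v) → Edge M u v
  leftFactor-edge⁺ u v a b h = ∧-intro a (∧-intro b h)

  embM-avoids-p0 : ∀ u → ¬ u ≡ p0 → ¬ embM c u ≡ p0
  embM-avoids-p0 p0 n _ = n refl
  embM-avoids-p0 p1 n ()
  embM-avoids-p0 (int i) n ()

  embM-avoids-cut : ∀ u → Active A1 u → ¬ u ≡ p1 → ¬ embM c u ≡ int c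
  embM-avoids-cut p0 _ _ ()
  embM-avoids-cut p1 _ n _ = n refl
  embM-avoids-cut (int i) a _ e = ≡false⇒≢true c∉A1 (subst (λ z → mem A1 z ≡ true) (int-injective e) a)

  embM-avoids-int : ∀ j → mem A1 j ≡ true → ∀ u → ¬ u ≡ int j → ¬ embM c u ≡ int j
  embM-avoids-int j aj p0 _ ()
  embM-avoids-int j aj p1 _ e = ≡false⇒≢true c∉A1 (subst (λ z → mem A1 z ≡ true) (sym (int-injective e)) aj)
  embM-avoids-int j aj (int i) n e = n e

  projL-avoids-p0 : ∀ y → Active U y × ¬ y ≡ p0 → Active A1 (projL y) × ¬ projL y ≡ p0
  projL-avoids-p0 p0 (_ , n) = ⊥-elim (n refl)
  projL-avoids-p0 p1 _ = tt , λ ()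
  projL-avoids-p0 (int i) _ with mem A1 i in e
  ... | true = e , λ ()
  ... | false = tt , λ ()

  projL′-avoids-p1 : ∀ y → Active U y × ¬ y ≡ int c → Active A1 (projL′ y) × ¬ projL′ y ≡ p1
  projL′-avoids-p1 p0 _ = tt , λ ()
  projL′-avoids-p1 p1 _ = tt , λ ()
  projL′-avoids-p1 (int i) _ with mem A1 i in e
  ... | true = e , λ ()
  ... | false = tt , λ ()

  projL-avoids-int : ∀ j y → Active U y × ¬ y ≡ int j → Active A1 (projL y) × ¬ projL y ≡ int j
  projL-avoids-int j p0 _ = tt , λ ()
  projL-avoids-int j p1 _ = tt , λ ()
  projL-avoids-int j (int i) (_ , n) with mem A1 i in e
  ... | true = e , n
  ... | false = tt , λ ()

  leftFactor-connected01-minus : ∀ x → Active A1 x → ConnectedOn (λ y → Active A1 y × ¬ (y ≡ x)) (add01 M)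
  leftFactor-connected01-minus p0 _ u v (au , nu) (av , nv) =
    Reach-map-onto projL projL-avoids-p0 (λ x y ux uy e → projL-edge01 x y (proj₁ ux) (proj₁ uy) e) (projL-embM u au) (projL-embM v av)
    (embM-active u au , embM-avoids-p0 u nu)
    (connected01-minus p0 tt (embM c u) (embM c v) (embM-active u au , embM-avoids-p0 u nu) (embM-active v av , embM-avoids-p0 v nv))
  leftFactor-connected01-minus p1 _ u v (au , nu) (av , nv) =
    Reach-map-onto projL′ projL′-avoids-p1 projL′-edge01 (projL′-embM u au nu) (projL′-embM v av nv)
    (embM-active u au , embM-avoids-cut u au nu)
    (connected01-minus (int c) c∈U (embM c u) (embM c v) (embM-active u au , embM-avoids-cut u au nu) (embM-active v av , embM-avoids-cut v av nv))
  leftFactor-connected01-minus (int j) aj u v (au , nu) (av , nv) =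
    Reach-map-onto projL (projL-avoids-int j) (λ x y ux uy e → projL-edge01 x y (proj₁ ux) (proj₁ uy) e) (projL-embM u au) (projL-embM v av)
    (embM-active u au , embM-avoids-int j aj u nu)
    (connected01-minus (int j) (A1⊆U j aj) (embM c u) (embM c v) (embM-active u au , embM-avoids-int j aj u nu) (embM-active v av , embM-avoids-int j aj v nv))

  leftFactor-isNetwork : IsNetwork A1 M
  leftFactor-isNetwork = (λ u v → ≡true-ext (λ e → adj-swap u v e) (λ e → adj-swap v u e)) ,
          (λ u → ≢true⇒≡false λ e → true≢false (trans (sym (proj₂ (proj₂ (leftFactor-edge⁻ u u e)))) (adj-irrefl _))) ,
          (λ u v e → activeB⇒Active u (proj₁ (leftFactor-edge⁻ u v e)) , activeB⇒Active v (proj₁ (proj₂ (leftFactor-edge⁻ u v e)))) ,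
          leftFactor-connected , leftFactor-connected01 , leftFactor-connected01-minus
    where
    adj-swap : ∀ u v → Edge M u v → Edge M v u
    adj-swap u v e with leftFactor-edge⁻ u v e
    ... | a , b , h = leftFactor-edge⁺ v u b a (edge-sym h)

  leftFactor-nonTrivial : NonTrivialNetwork A1 M
  leftFactor-nonTrivial = leftFactor-isNetwork , connected⇒nonTrivial leftFactor-connected

  N : Graph n
  N = rightFactor c B1 H

  projR : V n → V n
  projR p0 = p0
  projR p1 = p1
  projR (int i) = keepIf (mem B1 i) i p0

  projR′ : V n → V n
  projR′ p0 = p1
  projR′ p1 = p1
  projR′ (int i) = keepIf (mem B1 i) i p1

  LiftsToN : (V n → V n) → V n → Set
  LiftsToN π x = embN c (π x) ≡ x × activeB B1 (π x) ≡ true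

  rightSide⇒∈B1 : ∀ {i} → rightSide U c A1 (int i) ≡ true → mem B1 i ≡ true
  rightSide⇒∈B1 {i} r = trans (mem-B1 i) r

  rightSide-lifts : ∀ {x} → rightSide U c A1 x ≡ true → LiftsToN projR x
  rightSide-lifts {p1} _ = refl , refl
  rightSide-lifts {int i} r rewrite rightSide⇒∈B1 r = refl , rightSide⇒∈B1 r

  rightSide-lifts′ : ∀ {x} → rightSide U c A1 x ≡ true → LiftsToN projR′ x
  rightSide-lifts′ {p1} _ = refl , refl
  rightSide-lifts′ {int i} r rewrite rightSide⇒∈B1 r = refl , rightSide⇒∈B1 r

  cut-liftsN : LiftsToN projR (int c)
  cut-liftsN rewrite c∉B1 = refl , refl

  leftSide-projR : ∀ {x} → leftSide A1 x ≡ true → projR x ≡ p0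
  leftSide-projR {p0} _ = refl
  leftSide-projR {int i} l rewrite leftSide⇒∉B1 l = refl

  leftSide-projR′ : ∀ {x} → leftSide A1 x ≡ true → projR′ x ≡ p1
  leftSide-projR′ {p0} _ = refl
  leftSide-projR′ {int i} l rewrite leftSide⇒∉B1 l = refl

  cut-projR : projR (int c) ≡ p0
  cut-projR rewrite c∉B1 = refl

  edge-in-N : ∀ {π : V n → V n} {x y} → LiftsToN π x → LiftsToN π y → Edge H x y → Edge N (π x) (π y)
  edge-in-N {π} {x} {y} (ex , ax) (ey , ay) e =
    ∧-intro ax (∧-intro ay (subst (λ a → H a (embN c (π y)) ≡ true) (sym ex) (subst (λ b → H x b ≡ true) (sym ey) e)))

  projR-edge : ∀ x y → Active U x → Active U y → Edge H x y → projR x ≡ projR y ⊎ Edge N (projR x) (projR y)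
  projR-edge x y ux uy e with side x ux | side y uy
  ... | onRight rx | onRight ry = inj₂ (edge-in-N {projR} {x} {y} (rightSide-lifts rx) (rightSide-lifts ry) e)
  projR-edge x .(int c) ux uy e | onRight rx | atCut = inj₂ (edge-in-N {projR} {x} {int c} (rightSide-lifts rx) cut-liftsN e)
  projR-edge x y ux uy e | onRight rx | onLeft ly = ⊥-elim (no-edge-right-left e rx ly)
  projR-edge .(int c) y ux uy e | atCut | onRight ry = inj₂ (edge-in-N {projR} {int c} {y} cut-liftsN (rightSide-lifts ry) e)
  projR-edge .(int c) .(int c) ux uy e | atCut | atCut = inj₁ refl
  projR-edge .(int c) y ux uy e | atCut | onLeft ly = inj₁ (trans cut-projR (sym (leftSide-projR {y} ly)))
  projR-edge x y ux uy e | onLeft lx | onRight ry = ⊥-elim (no-edge-left-right e lx ry)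
  projR-edge x .(int c) ux uy e | onLeft lx | atCut = inj₁ (trans (leftSide-projR {x} lx) (sym cut-projR))
  projR-edge x y ux uy e | onLeft lx | onLeft ly = inj₁ (trans (leftSide-projR {x} lx) (sym (leftSide-projR {y} ly)))

  projR-edge01 : ∀ x y → Active U x → Active U y → Edge (add01 H) x y → projR x ≡ projR y ⊎ Edge (add01 N) (projR x) (projR y)
  projR-edge01 x y ux uy e with add01-elim {G = H} {x} {y} e
  ... | inj₁ e' with projR-edge x y ux uy e'
  ... | inj₁ q = inj₁ q
  ... | inj₂ q = inj₂ (add01-intro {G = N} {projR x} {projR y} q)
  projR-edge01 p0 p1 ux uy e | inj₂ pp = inj₂ (add01-01 {G = N})
  projR-edge01 p1 p0 ux uy e | inj₂ pp = inj₂ (add01-10 {G = N})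

  projR′-edge01 : ∀ x y → Active U x × ¬ x ≡ int c → Active U y × ¬ y ≡ int c → Edge (add01 H) x y →
            projR′ x ≡ projR′ y ⊎ Edge (add01 N) (projR′ x) (projR′ y)
  projR′-edge01 x y (ux , nx) (uy , ny) e with add01-elim {G = H} {x} {y} e
  ... | inj₁ e' with side x ux | side y uy
  ... | onRight rx | onRight ry = inj₂ (add01-intro {G = N} {projR′ x} {projR′ y} (edge-in-N {projR′} {x} {y} (rightSide-lifts′ rx) (rightSide-lifts′ ry) e'))
  ... | onRight rx | onLeft ly = ⊥-elim (no-edge-right-left e' rx ly)
  ... | onLeft lx | onRight ry = ⊥-elim (no-edge-left-right e' lx ry)
  ... | onLeft lx | onLeft ly = inj₁ (trans (leftSide-projR′ {x} lx) (sym (leftSide-projR′ {y} ly)))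
  ... | atCut | _ = ⊥-elim (nx refl)
  ... | _ | atCut = ⊥-elim (ny refl)
  projR′-edge01 p0 p1 _ _ e | inj₂ pp = inj₁ refl
  projR′-edge01 p1 p0 _ _ e | inj₂ pp = inj₁ refl

  embN-active : ∀ u → Active B1 u → Active U (embN c u)
  embN-active p0 _ = c∈U
  embN-active p1 _ = tt
  embN-active (int i) b = rightSide⇒∈U (trans (sym (mem-B1 i)) b)

  projR-embN : ∀ u → Active B1 u → projR (embN c u) ≡ u
  projR-embN p0 _ = cut-projR
  projR-embN p1 _ = refl
  projR-embN (int i) a rewrite a = refl

  projR′-embN : ∀ u → Active B1 u → ¬ u ≡ p0 → projR′ (embN c u) ≡ u
  projR′-embN p0 _ n = ⊥-elim (n refl)
  projR′-embN p1 _ _ = refl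
  projR′-embN (int i) a _ rewrite a = refl

  projR-active : ∀ x → Active U x → Active B1 (projR x)
  projR-active p0 _ = tt
  projR-active p1 _ = tt
  projR-active (int i) _ with mem B1 i in e
  ... | true = e
  ... | false = tt

  rightFactor-connected : ConnectedOn (Active B1) N
  rightFactor-connected u v au av = Reach-map-onto projR projR-active projR-edge (projR-embN u au) (projR-embN v av)
    (embN-active u au)
    (connected (embN c u) (embN c v) (embN-active u au) (embN-active v av))

  rightFactor-connected01 : ConnectedOn (Active B1) (add01 N)
  rightFactor-connected01 u v au av = Reach-map-onto projR projR-active projR-edge01 (projR-embN u au) (projR-embN v av)
    (embN-active u au)
    (connected01 (embN c u) (embN c v) (embN-active u au) (embN-active v av))

  rightFactor-edge⁻ : ∀ u v → Edge N u v → activeB B1 u ≡ true × activeB B1 v ≡ true × Edge H (embN c u) (embN c v)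
  rightFactor-edge⁻ u v e = ∧-elimˡ {activeB B1 u} e , ∧-elimˡ {activeB B1 v} (∧-elimʳ {activeB B1 u} e) , ∧-elimʳ {activeB B1 v} (∧-elimʳ {activeB B1 u} e)

  rightFactor-edge⁺ : ∀ u v → activeB B1 u ≡ true → activeB B1 v ≡ true → Edge H (embN c u) (embN c v) → Edge N u v
  rightFactor-edge⁺ u v a b h = ∧-intro a (∧-intro b h)

  embN-avoids-p1 : ∀ u → ¬ u ≡ p1 → ¬ embN c u ≡ p1
  embN-avoids-p1 p1 n _ = n refl
  embN-avoids-p1 p0 n ()
  embN-avoids-p1 (int i) n ()

  embN-avoids-cut : ∀ u → Active B1 u → ¬ u ≡ p0 → ¬ embN c u ≡ int c
  embN-avoids-cut p1 _ _ ()
  embN-avoids-cut p0 _ n _ = n refl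
  embN-avoids-cut (int i) a _ e = ≡false⇒≢true c∉B1 (subst (λ z → mem B1 z ≡ true) (int-injective e) a)

  embN-avoids-int : ∀ j → mem B1 j ≡ true → ∀ u → ¬ u ≡ int j → ¬ embN c u ≡ int j
  embN-avoids-int j aj p1 _ ()
  embN-avoids-int j aj p0 _ e = ≡false⇒≢true c∉B1 (subst (λ z → mem B1 z ≡ true) (sym (int-injective e)) aj)
  embN-avoids-int j aj (int i) n e = n e

  projR-avoids-p1 : ∀ y → Active U y × ¬ y ≡ p1 → Active B1 (projR y) × ¬ projR y ≡ p1
  projR-avoids-p1 p1 (_ , n) = ⊥-elim (n refl)
  projR-avoids-p1 p0 _ = tt , λ ()
  projR-avoids-p1 (int i) _ with mem B1 i in e
  ... | true = e , λ ()
  ... | false = tt , λ ()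

  projR′-avoids-p0 : ∀ y → Active U y × ¬ y ≡ int c → Active B1 (projR′ y) × ¬ projR′ y ≡ p0
  projR′-avoids-p0 p0 _ = tt , λ ()
  projR′-avoids-p0 p1 _ = tt , λ ()
  projR′-avoids-p0 (int i) _ with mem B1 i in e
  ... | true = e , λ ()
  ... | false = tt , λ ()

  projR-avoids-int : ∀ j y → Active U y × ¬ y ≡ int j → Active B1 (projR y) × ¬ projR y ≡ int j
  projR-avoids-int j p0 _ = tt , λ ()
  projR-avoids-int j p1 _ = tt , λ ()
  projR-avoids-int j (int i) (_ , n) with mem B1 i in e
  ... | true = e , n
  ... | false = tt , λ ()

  rightFactor-connected01-minus : ∀ x → Active B1 x → ConnectedOn (λ y → Active B1 y × ¬ (y ≡ x)) (add01 N)
  rightFactor-connected01-minus p1 _ u v (au , nu) (av , nv) =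
    Reach-map-onto projR projR-avoids-p1 (λ x y ux uy e → projR-edge01 x y (proj₁ ux) (proj₁ uy) e) (projR-embN u au) (projR-embN v av)
    (embN-active u au , embN-avoids-p1 u nu)
    (connected01-minus p1 tt (embN c u) (embN c v) (embN-active u au , embN-avoids-p1 u nu) (embN-active v av , embN-avoids-p1 v nv))
  rightFactor-connected01-minus p0 _ u v (au , nu) (av , nv) =
    Reach-map-onto projR′ projR′-avoids-p0 projR′-edge01 (projR′-embN u au nu) (projR′-embN v av nv)
    (embN-active u au , embN-avoids-cut u au nu)
    (connected01-minus (int c) c∈U (embN c u) (embN c v) (embN-active u au , embN-avoids-cut u au nu) (embN-active v av , embN-avoids-cut v av nv))
  rightFactor-connected01-minus (int j) aj u v (au , nu) (av , nv) =
    Reach-map-onto projR (projR-avoids-int j) (λ x y ux uy e → projR-edge01 x y (proj₁ ux) (proj₁ uy) e) (projR-embN u au) (projR-embN v av)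
    (embN-active u au , embN-avoids-int j aj u nu)
    (connected01-minus (int j) (embN-active (int j) aj) (embN c u) (embN c v) (embN-active u au , embN-avoids-int j aj u nu) (embN-active v av , embN-avoids-int j aj v nv))

  rightFactor-isNetwork : IsNetwork B1 N
  rightFactor-isNetwork = (λ u v → ≡true-ext (λ e → adj-swap u v e) (λ e → adj-swap v u e)) ,
          (λ u → ≢true⇒≡false λ e → true≢false (trans (sym (proj₂ (proj₂ (rightFactor-edge⁻ u u e)))) (adj-irrefl _))) ,
          (λ u v e → activeB⇒Active u (proj₁ (rightFactor-edge⁻ u v e)) , activeB⇒Active v (proj₁ (proj₂ (rightFactor-edge⁻ u v e)))) ,
          rightFactor-connected , rightFactor-connected01 , rightFactor-connected01-minus
    where
    adj-swap : ∀ u v → Edge N u v → Edge N v u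
    adj-swap u v e with rightFactor-edge⁻ u v e
    ... | a , b , h = rightFactor-edge⁺ v u b a (edge-sym h)

  rightFactor-nonTrivial : NonTrivialNetwork B1 N
  rightFactor-nonTrivial = rightFactor-isNetwork , connected⇒nonTrivial rightFactor-connected

  split : IsSplit U c A1 B1
  split i with i F.≟ c
  ... | yes refl rewrite c∉A1 | mem-B1 c | c∈U | c∉A1 | eqF-diag c = refl
  ... | no ne with mem A1 i in eA
  ... | true rewrite leftSide⇒∉B1 {i} eA | A1⊆U i eA = refl
  ... | false rewrite mem-B1 i | eA | ≢⇒eqF≡false ne with mem U i
  ... | true = refl
  ... | false = refl

  series : IsSeriesComp c M N H
  series u v = mk⇔ to from
    where
    toL : ∀ {u v} → LiftsToM projL u → LiftsToM projL v → Edge H u v → SeriesEdge c M N u v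
    toL {u} {v} gu gv e = inj₁ (projL u , projL v , proj₁ gu , proj₁ gv , edge-in-M {projL} {u} {v} gu gv e)
    toR : ∀ {u v} → LiftsToN projR u → LiftsToN projR v → Edge H u v → SeriesEdge c M N u v
    toR {u} {v} gu gv e = inj₂ (projR u , projR v , proj₁ gu , proj₁ gv , edge-in-N {projR} {u} {v} gu gv e)
    to : Edge H u v → SeriesEdge c M N u v
    to e with edge-active u v e
    ... | au , av with side u au | side v av
    ... | onLeft lu | onLeft lv = toL (leftSide-lifts lu) (leftSide-lifts lv) e
    ... | onLeft lu | atCut = toL (leftSide-lifts lu) cut-lifts e
    ... | onLeft lu | onRight rv = ⊥-elim (no-edge-left-right e lu rv)
    ... | atCut | onLeft lv = toL cut-lifts (leftSide-lifts lv) e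
    ... | atCut | atCut = toL cut-lifts cut-lifts e
    ... | atCut | onRight rv = toR cut-liftsN (rightSide-lifts rv) e
    ... | onRight ru | onLeft lv = ⊥-elim (no-edge-right-left e ru lv)
    ... | onRight ru | atCut = toR (rightSide-lifts ru) cut-liftsN e
    ... | onRight ru | onRight rv = toR (rightSide-lifts ru) (rightSide-lifts rv) e
    from : SeriesEdge c M N u v → Edge H u v
    from (inj₁ (a , b , refl , refl , m)) = proj₂ (proj₂ (leftFactor-edge⁻ a b m))
    from (inj₂ (a , b , refl , refl , m)) = proj₂ (proj₂ (rightFactor-edge⁻ a b m))

  decomposition : IsSeriesDecomposition U H c A1 M B1 N
  decomposition = split , leftFactor-nonTrivial , rightFactor-nonTrivial , series

separation⇒sNetwork : ∀ {n} {U : Subset n} {H : Graph n} → IsNetwork U H → ∀ {c A1} → Separation U H c A1 → IsSNetwork U H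
separation⇒sNetwork net {c} {A1} sep = c , A1 , FactorsOfSeparation.M net sep , FactorsOfSeparation.B1 net sep , FactorsOfSeparation.N net sep , FactorsOfSeparation.decomposition net sep

rightSideOf : ∀ {n} → Subset n → V n → Bool
rightSideOf B p0 = false
rightSideOf B p1 = true
rightSideOf B (int i) = mem B i

module DecompositionFacts {n} {U : Subset n} {G : Graph n} {c : Fin n} {A : Subset n} {M : Graph n} {B : Subset n} {N : Graph n}
  (d : IsSeriesDecomposition U G c A M B N) where
  sp : IsSplit U c A B
  sp = proj₁ d
  open SplitFacts {U = U} {c} {A} {B} sp public
  ntM : NonTrivialNetwork A M
  ntM = proj₁ (proj₂ d)
  ntN : NonTrivialNetwork B N
  ntN = proj₁ (proj₂ (proj₂ d))
  comp : IsSeriesComp c M N G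
  comp = proj₂ (proj₂ (proj₂ d))
  module MF = NetworkFacts (proj₁ ntM)
  module NF = NetworkFacts (proj₁ ntN)

  edge-cases : ∀ {u v} → Edge G u v → SeriesEdge c M N u v
  edge-cases {u} {v} e = Equivalence.to (comp u v) e

  edgeM : ∀ {a b} → Edge M a b → Edge G (embM c a) (embM c b)
  edgeM {a} {b} m = Equivalence.from (comp (embM c a) (embM c b)) (inj₁ (a , b , refl , refl , m))

  edgeN : ∀ {a b} → Edge N a b → Edge G (embN c a) (embN c b)
  edgeN {a} {b} m = Equivalence.from (comp (embN c a) (embN c b)) (inj₂ (a , b , refl , refl , m))

  embM-side : ∀ a → Active A a → leftSide A (embM c a) ≡ true ⊎ embM c a ≡ int c
  embM-side p0 _ = inj₁ refl
  embM-side p1 _ = inj₂ refl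
  embM-side (int i) a = inj₁ a

  embN-side : ∀ a → Active B a → rightSideOf B (embN c a) ≡ true ⊎ embN c a ≡ int c
  embN-side p0 _ = inj₂ refl
  embN-side p1 _ = inj₁ refl
  embN-side (int i) b = inj₁ b

  left-not-right : ∀ z → leftSide A z ≡ true → rightSideOf B z ≡ true → ⊥
  left-not-right p0 _ ()
  left-not-right p1 ()
  left-not-right (int i) a b = ≡false⇒≢true (A⇒¬B i a) b

  left-not-cut : ∀ z → leftSide A z ≡ true → z ≡ int c → ⊥
  left-not-cut .(int c) a refl = ≡false⇒≢true c∉A a

  right-not-cut : ∀ z → rightSideOf B z ≡ true → z ≡ int c → ⊥
  right-not-cut .(int c) b refl = ≡false⇒≢true c∉B b

  rightSide-not-left : ∀ z → rightSide U c A z ≡ true → leftSide A z ≡ true → ⊥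
  rightSide-not-left p0 ()
  rightSide-not-left p1 _ ()
  rightSide-not-left (int i) r l = ≡false⇒≢true (not≡true⇒≡false (∧-elimˡ {not (mem A i)} (∧-elimʳ {mem U i} r))) l

  rightSide-not-cut : ∀ z → rightSide U c A z ≡ true → z ≡ int c → ⊥
  rightSide-not-cut .(int c) r refl = ≡false⇒≢true (not≡true⇒≡false (∧-elimʳ {not (mem A c)} (∧-elimʳ {mem U c} r))) (eqF-diag c)

  separation : Separation U G c A
  separation = c∈U , A⊆U , c∉A , λ x y → ≢true⇒≡false λ e → no-cross-edge x y (∧-elimˡ {G x y} e) (∧-elimˡ {leftSide A x} (∧-elimʳ {G x y} e)) (∧-elimʳ {leftSide A x} (∧-elimʳ {G x y} e))
    where
    no-cross-edge : ∀ x y → Edge G x y → leftSide A x ≡ true → rightSide U c A y ≡ true → ⊥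
    no-cross-edge x y e lx ry with edge-cases e
    ... | inj₁ (a , b , refl , refl , m) with embM-side b (proj₂ (MF.edge-active a b m))
    ... | inj₁ lb = rightSide-not-left (embM c b) ry lb
    ... | inj₂ cb = rightSide-not-cut (embM c b) ry cb
    no-cross-edge x y e lx ry | inj₂ (a , b , refl , refl , m) with embN-side a (proj₁ (NF.edge-active a b m))
    ... | inj₁ ra = left-not-right (embN c a) lx ra
    ... | inj₂ ca = left-not-cut (embN c a) lx ca

sNetwork⇒separation : ∀ {n} {U : Subset n} {H : Graph n} → IsSNetwork U H → ∃ λ c → ∃ λ A1 → Separation U H c A1
sNetwork⇒separation (c , A , M , B , N , d) = c , A , DecompositionFacts.separation d

module DecompositionWalks {n} {U : Subset n} {G : Graph n} {c : Fin n} {A : Subset n} {M : Graph n} {B : Subset n} {N : Graph n}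
  (d : IsSeriesDecomposition U G c A M B N) where
  open DecompositionFacts {U = U} {G} {c} {A} {M} {B} {N} d

  walk-stays-left : ∀ {Q : V n → Set} → (∀ z → Q z → ¬ z ≡ int c) → ∀ {x y} → Reach Q G x y → leftSide A x ≡ true → leftSide A y ≡ true
  walk-stays-left avoids here l = l
  walk-stays-left avoids (step e qw r) l with edge-cases e
  ... | inj₁ (a , b , refl , refl , m) with embM-side b (proj₂ (MF.edge-active a b m))
  ... | inj₁ lb = walk-stays-left avoids r lb
  ... | inj₂ cb = ⊥-elim (avoids _ qw cb)
  walk-stays-left avoids (step e qw r) l | inj₂ (a , b , refl , refl , m) with embN-side a (proj₁ (NF.edge-active a b m))
  ... | inj₁ ra = ⊥-elim (left-not-right (embN c a) l ra)
  ... | inj₂ ca = ⊥-elim (left-not-cut (embN c a) l ca)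

  walk-stays-right : ∀ {Q : V n → Set} → (∀ z → Q z → ¬ z ≡ int c) → ∀ {x y} → Reach Q G x y → rightSideOf B x ≡ true → rightSideOf B y ≡ true
  walk-stays-right avoids here l = l
  walk-stays-right avoids (step e qw r) l with edge-cases e
  ... | inj₂ (a , b , refl , refl , m) with embN-side b (proj₂ (NF.edge-active a b m))
  ... | inj₁ rb = walk-stays-right avoids r rb
  ... | inj₂ cb = ⊥-elim (avoids _ qw cb)
  walk-stays-right avoids (step e qw r) l | inj₁ (a , b , refl , refl , m) with embM-side a (proj₁ (MF.edge-active a b m))
  ... | inj₁ la = ⊥-elim (left-not-right (embM c a) la l)
  ... | inj₂ ca = ⊥-elim (right-not-cut (embM c a) l ca)

  embM-walk : ∀ {Q : V n → Set} → (∀ a → Active A a → Q (embM c a)) → ∀ {u v} → Active A u →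
             Reach (Active A) M u v → Reach Q G (embM c u) (embM c v)
  embM-walk avoids au r = Reach-map (embM c) avoids (λ x y _ _ m → inj₂ (edgeM m)) au r

  embN-walk : ∀ {Q : V n → Set} → (∀ a → Active B a → Q (embN c a)) → ∀ {u v} → Active B u →
             Reach (Active B) N u v → Reach Q G (embN c u) (embN c v)
  embN-walk avoids au r = Reach-map (embN c) avoids (λ x y _ _ m → inj₂ (edgeN m)) au r

  embM-walk-avoiding-p1 : ∀ {Q : V n → Set} → (∀ a → Active A a × ¬ a ≡ p1 → Q (embM c a)) → ∀ {u v} → Active A u × ¬ u ≡ p1 →
             Reach (λ y → Active A y × ¬ y ≡ p1) (add01 M) u v → Reach Q G (embM c u) (embM c v)
  embM-walk-avoiding-p1 {Q} avoids au r = Reach-map (embM c) avoids edge-image au r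
    where
    edge-image : ∀ x y → Active A x × ¬ x ≡ p1 → Active A y × ¬ y ≡ p1 → Edge (add01 M) x y → embM c x ≡ embM c y ⊎ Edge G (embM c x) (embM c y)
    edge-image x y (_ , nx) (_ , ny) e with add01-elim {G = M} {x} {y} e
    ... | inj₁ m = inj₂ (edgeM m)
    edge-image p0 p1 (_ , nx) (_ , ny) e | inj₂ _ = ⊥-elim (ny refl)
    edge-image p1 p0 (_ , nx) (_ , ny) e | inj₂ _ = ⊥-elim (nx refl)

  embN-walk-avoiding-p0 : ∀ {Q : V n → Set} → (∀ a → Active B a × ¬ a ≡ p0 → Q (embN c a)) → ∀ {u v} → Active B u × ¬ u ≡ p0 →
             Reach (λ y → Active B y × ¬ y ≡ p0) (add01 N) u v → Reach Q G (embN c u) (embN c v)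
  embN-walk-avoiding-p0 {Q} avoids au r = Reach-map (embN c) avoids edge-image au r
    where
    edge-image : ∀ x y → Active B x × ¬ x ≡ p0 → Active B y × ¬ y ≡ p0 → Edge (add01 N) x y → embN c x ≡ embN c y ⊎ Edge G (embN c x) (embN c y)
    edge-image x y (_ , nx) (_ , ny) e with add01-elim {G = N} {x} {y} e
    ... | inj₁ m = inj₂ (edgeN m)
    edge-image p0 p1 (_ , nx) (_ , ny) e | inj₂ _ = ⊥-elim (nx refl)
    edge-image p1 p0 (_ , nx) (_ , ny) e | inj₂ _ = ⊥-elim (ny refl)

  p0-reaches-first-avoiding : ∀ (k : Fin n) → ¬ k ≡ c → mem A k ≡ false → ∀ u → Active A u → Reach (λ z → ¬ z ≡ int k) G p0 (embM c u)
  p0-reaches-first-avoiding k kc kA u au = embM-walk avoids tt (MF.connected p0 u tt au)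
    where
    avoids : ∀ a → Active A a → ¬ embM c a ≡ int k
    avoids p0 _ ()
    avoids p1 _ e = kc (sym (int-injective e))
    avoids (int i) ai e = ≡false⇒≢true kA (subst (λ z → mem A z ≡ true) (int-injective e) ai)

  p1-reaches-second-avoiding : ∀ (k : Fin n) → ¬ k ≡ c → mem B k ≡ false → ∀ u → Active B u → Reach (λ z → ¬ z ≡ int k) G p1 (embN c u)
  p1-reaches-second-avoiding k kc kB u au = embN-walk avoids tt (NF.connected p1 u tt au)
    where
    avoids : ∀ a → Active B a → ¬ embN c a ≡ int k
    avoids p1 _ ()
    avoids p0 _ e = kc (sym (int-injective e))
    avoids (int i) ai e = ≡false⇒≢true kB (subst (λ z → mem B z ≡ true) (int-injective e) ai)

  p0-reaches-A-avoiding-cut : ∀ i → mem A i ≡ true → Reach (λ z → ¬ z ≡ int c) G p0 (int i)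
  p0-reaches-A-avoiding-cut i ai = embM-walk-avoiding-p1 avoids (tt , λ ()) (MF.connected01-minus p1 tt p0 (int i) (tt , λ ()) (ai , λ ()))
    where
    avoids : ∀ a → Active A a × ¬ a ≡ p1 → ¬ embM c a ≡ int c
    avoids p0 _ ()
    avoids p1 (_ , n) _ = n refl
    avoids (int j) (aj , _) e = ≡false⇒≢true c∉A (subst (λ z → mem A z ≡ true) (int-injective e) aj)

  p1-reaches-B-avoiding-cut : ∀ i → mem B i ≡ true → Reach (λ z → ¬ z ≡ int c) G p1 (int i)
  p1-reaches-B-avoiding-cut i bi = embN-walk-avoiding-p0 avoids (tt , λ ()) (NF.connected01-minus p0 tt p1 (int i) (tt , λ ()) (bi , λ ()))
    where
    avoids : ∀ a → Active B a × ¬ a ≡ p0 → ¬ embN c a ≡ int c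
    avoids p1 _ ()
    avoids p0 (_ , n) _ = n refl
    avoids (int j) (bj , _) e = ≡false⇒≢true c∉B (subst (λ z → mem B z ≡ true) (int-injective e) bj)

module DistinctCuts {n} {U : Subset n} {G : Graph n} {c : Fin n} {A : Subset n} {M : Graph n} {B : Subset n} {N : Graph n}
  {c' : Fin n} {A' : Subset n} {M' : Graph n} {B' : Subset n} {N' : Graph n}
  (d : IsSeriesDecomposition U G c A M B N) (d' : IsSeriesDecomposition U G c' A' M' B' N') where
  module D = DecompositionFacts {U = U} {G} {c} {A} {M} {B} {N} d
  module D' = DecompositionFacts {U = U} {G} {c'} {A'} {M'} {B'} {N'} d'
  module W = DecompositionWalks {U = U} {G} {c} {A} {M} {B} {N} d
  module W' = DecompositionWalks {U = U} {G} {c'} {A'} {M'} {B'} {N'} d'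

  cut∈B⇒first-is-sNetwork : mem B c' ≡ true → IsSNetwork A' M'
  cut∈B⇒first-is-sNetwork bc' = separation⇒sNetwork (proj₁ D'.ntM) separation′
    where
    c′≢c : ¬ c' ≡ c
    c′≢c = D.B∌c c' bc'
    c′∉A : mem A c' ≡ false
    c′∉A = ≢true⇒≡false λ a → ≡false⇒≢true (D.A⇒¬B c' a) bc'
    first⇒left′ : ∀ u → Active A u → leftSide A' (embM c u) ≡ true
    first⇒left′ u au = W'.walk-stays-left (λ z q → q) (W.p0-reaches-first-avoiding c' c′≢c c′∉A u au) refl
    embM-left : ∀ x → leftSide A x ≡ true → embM c' x ≡ x
    embM-left p0 _ = refl
    embM-left (int i) _ = refl
    right⇒outside-first : ∀ y → rightSide A' c A y ≡ true → leftSide A (embM c' y) ≡ false × ¬ embM c' y ≡ int c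
    right⇒outside-first p1 _ = c′∉A , λ e → c′≢c (int-injective e)
    right⇒outside-first (int j) r = not≡true⇒≡false (∧-elimˡ {not (mem A j)} (∧-elimʳ {mem A' j} r)) ,
                     λ e → ≡false⇒≢true (not≡true⇒≡false (∧-elimʳ {not (mem A j)} (∧-elimʳ {mem A' j} r))) (subst (λ z → eqF j z ≡ true) (int-injective e) (eqF-diag j))
    no-cross-edge : ∀ x y → Edge M' x y → leftSide A x ≡ true → rightSide A' c A y ≡ true → ⊥
    no-cross-edge x y m lx ry with D.edge-cases (D'.edgeM m)
    ... | inj₁ (a , b , ea , eb , mm) with D.embM-side b (proj₂ (D.MF.edge-active a b mm))
    ...   | inj₁ lb = ≡false⇒≢true (proj₁ (right⇒outside-first y ry)) (subst (λ z → leftSide A z ≡ true) eb lb)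
    ...   | inj₂ cb = proj₂ (right⇒outside-first y ry) (trans (sym eb) cb)
    no-cross-edge x y m lx ry | inj₂ (a , b , ea , eb , nn) with D.embN-side a (proj₁ (D.NF.edge-active a b nn))
    ...   | inj₁ ra = D.left-not-right x lx (subst (λ z → rightSideOf B z ≡ true) (trans ea (embM-left x lx)) ra)
    ...   | inj₂ ca = D.left-not-cut x lx (trans (sym (trans ea (embM-left x lx))) ca)
    separation′ : Separation A' M' c A
    separation′ = first⇒left′ p1 tt , (λ i a → first⇒left′ (int i) a) , D.c∉A ,
           λ x y → ≢true⇒≡false λ e → no-cross-edge x y (∧-elimˡ {M' x y} e) (∧-elimˡ {leftSide A x} (∧-elimʳ {M' x y} e)) (∧-elimʳ {leftSide A x} (∧-elimʳ {M' x y} e))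

  cut∈A⇒cut′∈B′ : ¬ c ≡ c' → mem A c' ≡ true → mem B' c ≡ true
  cut∈A⇒cut′∈B′ ne ac' = W'.walk-stays-right (λ z q → q) (W.p1-reaches-second-avoiding c' (λ e → ne (sym e)) (D.A⇒¬B c' ac') p0 tt) refl

module SameCut {n} {U : Subset n} {G : Graph n} {c : Fin n} {A : Subset n} {M : Graph n} {B : Subset n} {N : Graph n}
  {A' : Subset n} {M' : Graph n} {B' : Subset n} {N' : Graph n}
  (d : IsSeriesDecomposition U G c A M B N) (d' : IsSeriesDecomposition U G c A' M' B' N') where
  module D = DecompositionFacts {U = U} {G} {c} {A} {M} {B} {N} d
  module D' = DecompositionFacts {U = U} {G} {c} {A'} {M'} {B'} {N'} d'
  module W = DecompositionWalks {U = U} {G} {c} {A} {M} {B} {N} d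
  module W' = DecompositionWalks {U = U} {G} {c} {A'} {M'} {B'} {N'} d'

  A⊆A′ : ∀ i → mem A i ≡ true → mem A' i ≡ true
  A⊆A′ i a = W'.walk-stays-left (λ z q → q) (W.p0-reaches-A-avoiding-cut i a) refl

  B⊆B′ : ∀ i → mem B i ≡ true → mem B' i ≡ true
  B⊆B′ i b = W'.walk-stays-right (λ z q → q) (W.p1-reaches-B-avoiding-cut i b) refl

  embM-injective : ∀ {a u} → Active A a → Active A u → embM c a ≡ embM c u → a ≡ u
  embM-injective {p0} {p0} _ _ _ = refl
  embM-injective {p1} {p1} _ _ _ = refl
  embM-injective {int i} {int j} _ _ e = e
  embM-injective {p1} {int j} _ aj e = ⊥-elim (≡false⇒≢true D.c∉A (subst (λ z → mem A z ≡ true) (sym (int-injective e)) aj))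
  embM-injective {int i} {p1} ai _ e = ⊥-elim (≡false⇒≢true D.c∉A (subst (λ z → mem A z ≡ true) (int-injective e) ai))
  embM-injective {p0} {p1} _ _ ()
  embM-injective {p0} {int _} _ _ ()
  embM-injective {p1} {p0} _ _ ()
  embM-injective {int _} {p0} _ _ ()

  embN-injective : ∀ {a u} → Active B a → Active B u → embN c a ≡ embN c u → a ≡ u
  embN-injective {p0} {p0} _ _ _ = refl
  embN-injective {p1} {p1} _ _ _ = refl
  embN-injective {int i} {int j} _ _ e = e
  embN-injective {p0} {int j} _ aj e = ⊥-elim (≡false⇒≢true D.c∉B (subst (λ z → mem B z ≡ true) (sym (int-injective e)) aj))
  embN-injective {int i} {p0} ai _ e = ⊥-elim (≡false⇒≢true D.c∉B (subst (λ z → mem B z ≡ true) (int-injective e) ai))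
  embN-injective {p1} {p0} _ _ ()
  embN-injective {p1} {int _} _ _ ()
  embN-injective {p0} {p1} _ _ ()
  embN-injective {int _} {p1} _ _ ()

  embM≡cut : ∀ u → Active A u → embM c u ≡ int c → u ≡ p1
  embM≡cut p1 _ _ = refl
  embM≡cut p0 _ ()
  embM≡cut (int i) ai e = ⊥-elim (≡false⇒≢true D.c∉A (subst (λ z → mem A z ≡ true) (int-injective e) ai))

  embN≡cut : ∀ u → Active B u → embN c u ≡ int c → u ≡ p0
  embN≡cut p0 _ _ = refl
  embN≡cut p1 _ ()
  embN≡cut (int i) bi e = ⊥-elim (≡false⇒≢true D.c∉B (subst (λ z → mem B z ≡ true) (int-injective e) bi))

  module SameParts (A≡A′ : A' ≡ A) (B≡B′ : B' ≡ B) where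
    first-not-second′ : ∀ u → Active A u → rightSideOf B' (embM c u) ≡ true → ⊥
    first-not-second′ u au rb with D.embM-side u au
    ... | inj₁ lu = D'.left-not-right (embM c u) (subst (λ X → leftSide X (embM c u) ≡ true) (sym A≡A′) lu) rb
    ... | inj₂ cu = D'.right-not-cut (embM c u) rb cu

    second-not-first′ : ∀ u → Active B u → leftSide A' (embN c u) ≡ true → ⊥
    second-not-first′ u bu la with D.embN-side u bu
    ... | inj₁ ru = D'.left-not-right (embN c u) la (subst (λ X → rightSideOf X (embN c u) ≡ true) (sym B≡B′) ru)
    ... | inj₂ cu = D'.left-not-cut (embN c u) la cu

    active-A′⇒A : ∀ a → Active A' a → Active A a
    active-A′⇒A a x = subst (λ X → Active X a) A≡A′ x
    active-B′⇒B : ∀ a → Active B' a → Active B a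
    active-B′⇒B a x = subst (λ X → Active X a) B≡B′ x

    M⊆M′ : ∀ u v → Edge M u v → Edge M' u v
    M⊆M′ u v m with D.MF.edge-active u v m | D'.edge-cases (D.edgeM m)
    ... | au , av | inj₁ (a , b , ea , eb , m') with D'.MF.edge-active a b m'
    ...   | aa , ab with embM-injective (active-A′⇒A a aa) au ea | embM-injective (active-A′⇒A b ab) av eb
    ...     | refl | refl = m'
    M⊆M′ u v m | au , av | inj₂ (a , b , ea , eb , n') with D'.NF.edge-active a b n'
    ...   | ba , bb with D'.embN-side a ba | D'.embN-side b bb
    ...     | inj₁ ra | _ = ⊥-elim (first-not-second′ u au (subst (λ z → rightSideOf B' z ≡ true) ea ra))
    ...     | inj₂ _ | inj₁ rb = ⊥-elim (first-not-second′ v av (subst (λ z → rightSideOf B' z ≡ true) eb rb))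
    ...     | inj₂ ca | inj₂ cb with embM≡cut u au (trans (sym ea) ca) | embM≡cut v av (trans (sym eb) cb)
    ...       | refl | refl = ⊥-elim (true≢false (trans (sym m) (D.MF.adj-irrefl p1)))

    N⊆N′ : ∀ u v → Edge N u v → Edge N' u v
    N⊆N′ u v m with D.NF.edge-active u v m | D'.edge-cases (D.edgeN m)
    ... | au , av | inj₂ (a , b , ea , eb , m') with D'.NF.edge-active a b m'
    ...   | aa , ab with embN-injective (active-B′⇒B a aa) au ea | embN-injective (active-B′⇒B b ab) av eb
    ...     | refl | refl = m'
    N⊆N′ u v m | au , av | inj₁ (a , b , ea , eb , n') with D'.MF.edge-active a b n'
    ...   | ba , bb with D'.embM-side a ba | D'.embM-side b bb
    ...     | inj₁ la | _ = ⊥-elim (second-not-first′ u au (subst (λ z → leftSide A' z ≡ true) ea la))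
    ...     | inj₂ _ | inj₁ lb = ⊥-elim (second-not-first′ v av (subst (λ z → leftSide A' z ≡ true) eb lb))
    ...     | inj₂ ca | inj₂ cb with embN≡cut u au (trans (sym ea) ca) | embN≡cut v av (trans (sym eb) cb)
    ...       | refl | refl = ⊥-elim (true≢false (trans (sym m) (D.NF.adj-irrefl p0)))

decomposition-unique-at-cut : ∀ {n} {U : Subset n} {G : Graph n} {c : Fin n} {A : Subset n} {M : Graph n} {B : Subset n} {N : Graph n}
  {A' : Subset n} {M' : Graph n} {B' : Subset n} {N' : Graph n} →
  IsSeriesDecomposition U G c A M B N → IsSeriesDecomposition U G c A' M' B' N' →
  A ≡ A' × GraphEq M M' × B ≡ B' × GraphEq N N'
decomposition-unique-at-cut {U = U} {G} {c} {A} {M} {B} {N} {A'} {M'} {B'} {N'} d d' =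
  A≡A′ , (λ u v → ≡true-ext (S.SameParts.M⊆M′ (sym A≡A′) (sym B≡B′) u v) (S'.SameParts.M⊆M′ A≡A′ B≡B′ u v)) ,
  B≡B′ , (λ u v → ≡true-ext (S.SameParts.N⊆N′ (sym A≡A′) (sym B≡B′) u v) (S'.SameParts.N⊆N′ A≡A′ B≡B′ u v))
  where
  module S = SameCut {U = U} {G} {c} {A} {M} {B} {N} {A'} {M'} {B'} {N'} d d'
  module S' = SameCut {U = U} {G} {c} {A'} {M'} {B'} {N'} {A} {M} {B} {N} d' d
  A≡A′ : A ≡ A'
  A≡A′ = lookup-ext λ i → ≡true-ext (S.A⊆A′ i) (S'.A⊆A′ i)
  B≡B′ : B ≡ B'
  B≡B′ = lookup-ext λ i → ≡true-ext (S.B⊆B′ i) (S'.B⊆B′ i)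

-- For distinct cuts c′ lies in A or in B; in either case one of the first factors is an s-network.
canonical-decomposition-unique : ∀ {n} {U : Subset n} {G : Graph n} {c : Fin n} {A : Subset n} {M : Graph n} {B : Subset n} {N : Graph n}
  {c' : Fin n} {A' : Subset n} {M' : Graph n} {B' : Subset n} {N' : Graph n} →
  IsSeriesDecomposition U G c A M B N → IsSeriesDecomposition U G c' A' M' B' N' →
  ¬ IsSNetwork A M → ¬ IsSNetwork A' M' →
  c ≡ c' × A ≡ A' × GraphEq M M' × B ≡ B' × GraphEq N N'
canonical-decomposition-unique {U = U} {G} {c} {A} {M} {B} {N} {c'} {A'} {M'} {B'} {N'} d d' nsM nsM' with c F.≟ c'
... | no ne with DecompositionFacts.U-cases {U = U} {G} {c} {A} {M} {B} {N} d c' (DecompositionFacts.c∈U {U = U} {G} {c'} {A'} {M'} {B'} {N'} d')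
...   | inj₁ e = ⊥-elim (ne (sym e))
...   | inj₂ (inj₂ bc') = ⊥-elim (nsM' (DistinctCuts.cut∈B⇒first-is-sNetwork {U = U} {G} {c} {A} {M} {B} {N} {c'} {A'} {M'} {B'} {N'} d d' bc'))
...   | inj₂ (inj₁ ac') = ⊥-elim (nsM (DistinctCuts.cut∈B⇒first-is-sNetwork {U = U} {G} {c'} {A'} {M'} {B'} {N'} {c} {A} {M} {B} {N} d' d
                             (DistinctCuts.cut∈A⇒cut′∈B′ {U = U} {G} {c} {A} {M} {B} {N} {c'} {A'} {M'} {B'} {N'} d d' ne ac')))
canonical-decomposition-unique {U = U} {G} {c} {A} {M} {B} {N} {.c} {A'} {M'} {B'} {N'} d d' nsM nsM' | yes refl =
  refl , decomposition-unique-at-cut {U = U} {G} {c} {A} {M} {B} {N} {A'} {M'} {B'} {N'} d d'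

separation? : ∀ {n} (U : Subset n) (H : Graph n) c A1 → Dec (Separation U H c A1)
separation? U H c A1 = (mem U c BP.≟ true) ×-dec
                FP.all? (λ i → (mem A1 i BP.≟ true) →-dec (mem U i BP.≟ true)) ×-dec
                (mem A1 c BP.≟ false) ×-dec
                all-V? (λ x → all-V? (λ y → (H x y ∧ leftSide A1 x ∧ rightSide U c A1 y) BP.≟ false))

∃separation? : ∀ {n} (U : Subset n) (H : Graph n) → Dec (∃ λ c → ∃ λ A1 → Separation U H c A1)
∃separation? U H = FP.any? (λ c → anySubset? (λ A1 → separation? U H c A1))

sNetwork? : ∀ {n} {U : Subset n} {H : Graph n} → IsNetwork U H → Dec (IsSNetwork U H)
sNetwork? {U = U} {H} net with ∃separation? U H
... | yes (c , A1 , s) = yes (separation⇒sNetwork net s)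
... | no ns = no λ x → ns (sNetwork⇒separation x)

mem⇒∈ : ∀ {n} {A : Subset n} {i} → mem A i ≡ true → i ∈ A
mem⇒∈ {A = A} {i} = VP.lookup⇒[]= i A

∈⇒mem : ∀ {n} {A : Subset n} {i} → i ∈ A → mem A i ≡ true
∈⇒mem = VP.[]=⇒lookup

separation⇒⊂ : ∀ {n} {U : Subset n} {H : Graph n} {c A} → Separation U H c A → A ⊂ U
separation⇒⊂ (c∈U , A⊆U , c∉A , _) =
  (λ i∈A → mem⇒∈ (A⊆U _ (∈⇒mem i∈A))) , _ , mem⇒∈ c∈U , λ c∈A → ≡false⇒≢true c∉A (∈⇒mem c∈A)

separation-of-first-factor : ∀ {n} {U : Subset n} {H : Graph n} {c A1 c' A1'} →
  Separation U H c A1 → Separation A1 (leftFactor c A1 H) c' A1' → Separation U H c' A1'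
separation-of-first-factor {n} {U} {H} {c} {A1} {c'} {A1'} (c∈U , A1⊆U , c∉A1 , no-cross-edge) (c′∈A1 , A1′⊆A1 , c′∉A1′ , no-cross-edge′) =
  A1⊆U c' c′∈A1 , (λ i a → A1⊆U i (A1′⊆A1 i a)) , c′∉A1′ ,
  λ x y → ≢true⇒≡false λ e → no-cross x y (∧-elimˡ {H x y} e) (∧-elimˡ {leftSide A1' x} (∧-elimʳ {H x y} e)) (∧-elimʳ {leftSide A1' x} (∧-elimʳ {H x y} e))
  where
  left′⇒left : ∀ x → leftSide A1' x ≡ true → leftSide A1 x ≡ true
  left′⇒left p0 _ = refl
  left′⇒left (int i) a = A1′⊆A1 i a
  embM-left : ∀ x → leftSide A1 x ≡ true → embM c x ≡ x
  embM-left p0 _ = refl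
  embM-left (int i) _ = refl
  left⇒active : ∀ x → leftSide A1 x ≡ true → activeB A1 x ≡ true
  left⇒active p0 _ = refl
  left⇒active (int i) a = a
  no-cross-H : ∀ x y → Edge H x y → leftSide A1 x ≡ true → rightSide U c A1 y ≡ true → ⊥
  no-cross-H x y e l r = true≢false (trans (sym (∧-intro e (∧-intro l r))) (no-cross-edge x y))
  no-cross-M : ∀ x y → Edge (leftFactor c A1 H) x y → leftSide A1' x ≡ true → rightSide A1 c' A1' y ≡ true → ⊥
  no-cross-M x y e l r = true≢false (trans (sym (∧-intro e (∧-intro l r))) (no-cross-edge′ x y))
  no-cross-via-M : ∀ x y' → leftSide A1' x ≡ true → activeB A1 y' ≡ true → Edge H x (embM c y') → rightSide A1 c' A1' y' ≡ true → ⊥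
  no-cross-via-M x y' l ay e r = no-cross-M x y' (∧-intro (left⇒active x (left′⇒left x l)) (∧-intro ay (subst (λ z → H z (embM c y') ≡ true) (sym (embM-left x (left′⇒left x l))) e))) l r
  no-cross : ∀ x y → Edge H x y → leftSide A1' x ≡ true → rightSide U c' A1' y ≡ true → ⊥
  no-cross x p0 e l ()
  no-cross x p1 e l r = no-cross-H x p1 e (left′⇒left x l) refl
  no-cross x (int j) e l r with mem A1 j in aj | j F.≟ c
  ... | true | _ = no-cross-via-M x (int j) l aj e (∧-intro aj (∧-elimʳ {mem U j} r))
  ... | false | yes refl = no-cross-via-M x p1 l refl e refl
  ... | false | no ne = no-cross-H x (int j) e (left′⇒left x l) (∧-intro (∧-elimˡ {mem U j} r) (∧-intro (≡false⇒not≡true aj) (≡false⇒not≡true (≢⇒eqF≡false ne))))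

CanonicalSplit : ∀ {n} → Subset n → Graph n → Set
CanonicalSplit U H = ∃ λ c → ∃ λ A1 → Separation U H c A1 × ¬ IsSNetwork A1 (leftFactor c A1 H)

-- Opaque because only the properties of the chosen split matter, and unfolding the search in
-- conversion checks below is very expensive.
opaque
  -- Splitting off the first factor again and again terminates, since its underlying set shrinks.
  canonical-split-below : ∀ {n} {U : Subset n} {H : Graph n} → IsNetwork U H →
    (k : ℕ) → ∀ c A → ∣ A ∣ < k → Separation U H c A → CanonicalSplit U H
  canonical-split-below {U = U} {H} net (suc k) c A ∣A∣<k s with sNetwork? (FactorsOfSeparation.leftFactor-isNetwork net s)
  ... | no ns = c , A , s , ns
  ... | yes sn with sNetwork⇒separation sn
  ...   | c′ , A′ , s′ = canonical-split-below net k c′ A′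
          (ℕP.<-≤-trans (p⊂q⇒∣p∣<∣q∣ (separation⇒⊂ {H = leftFactor c A H} s′)) (ℕP.≤-pred ∣A∣<k)) (separation-of-first-factor {U = U} {H} {c} {A} {c′} {A′} s s′)

  canonical-split : ∀ {n} {U : Subset n} {H : Graph n} → IsNetwork U H → IsSNetwork U H → CanonicalSplit U H
  canonical-split net sn with sNetwork⇒separation sn
  ... | c , A , s = canonical-split-below net (suc ∣ A ∣) c A ℕP.≤-refl s

actV⁻¹ : ∀ {n} → Permutation′ n → V n → V n
actV⁻¹ σ p0 = p0
actV⁻¹ σ p1 = p1
actV⁻¹ σ (int j) = int (σ ⟨$⟩ˡ j)

actGraph-apply : ∀ {n} (σ : Permutation′ n) (G : Graph n) u v → actGraph σ G u v ≡ G (actV⁻¹ σ u) (actV⁻¹ σ v)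
actGraph-apply σ G p0 p0 = refl
actGraph-apply σ G p0 p1 = refl
actGraph-apply σ G p0 (int _) = refl
actGraph-apply σ G p1 p0 = refl
actGraph-apply σ G p1 p1 = refl
actGraph-apply σ G p1 (int _) = refl
actGraph-apply σ G (int _) p0 = refl
actGraph-apply σ G (int _) p1 = refl
actGraph-apply σ G (int _) (int _) = refl

mem-actSubset : ∀ {n} (σ : Permutation′ n) (A : Subset n) j → mem (actSubset σ A) j ≡ mem A (σ ⟨$⟩ˡ j)
mem-actSubset σ A j = mem-tabulate _ j

eqF-act : ∀ {n} (σ : Permutation′ n) j c → eqF j (σ ⟨$⟩ʳ c) ≡ eqF (σ ⟨$⟩ˡ j) c
eqF-act σ j c = ≡true-ext (λ e → eqF≡ (trans (cong (σ ⟨$⟩ˡ_) (eqF⇒≡ e)) (P.inverseˡ σ)))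
                        (λ e → eqF≡ (trans (sym (P.inverseʳ σ)) (cong (σ ⟨$⟩ʳ_) (eqF⇒≡ e))))
  where
  eqF≡ : ∀ {n} {i j : Fin n} → i ≡ j → eqF i j ≡ true
  eqF≡ {i = i} refl = eqF-diag i

actV⁻¹-flip : ∀ {n} (σ : Permutation′ n) u → actV⁻¹ σ (actV⁻¹ (P.flip σ) u) ≡ u
actV⁻¹-flip σ p0 = refl
actV⁻¹-flip σ p1 = refl
actV⁻¹-flip σ (int i) = cong int (P.inverseˡ σ)

activeB-act : ∀ {n} (σ : Permutation′ n) (A : Subset n) u → activeB (actSubset σ A) u ≡ activeB A (actV⁻¹ σ u)
activeB-act σ A p0 = refl
activeB-act σ A p1 = refl
activeB-act σ A (int j) = mem-actSubset σ A j

leftSide-act : ∀ {n} (σ : Permutation′ n) (A : Subset n) u → leftSide (actSubset σ A) u ≡ leftSide A (actV⁻¹ σ u)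
leftSide-act σ A p0 = refl
leftSide-act σ A p1 = refl
leftSide-act σ A (int j) = mem-actSubset σ A j

rightSide-act : ∀ {n} (σ : Permutation′ n) (U A : Subset n) c u →
  rightSide (actSubset σ U) (σ ⟨$⟩ʳ c) (actSubset σ A) u ≡ rightSide U c A (actV⁻¹ σ u)
rightSide-act σ U A c p0 = refl
rightSide-act σ U A c p1 = refl
rightSide-act σ U A c (int j) rewrite mem-actSubset σ U j | mem-actSubset σ A j | eqF-act σ j c = refl

separation-act : ∀ {n} (σ : Permutation′ n) {U : Subset n} {H : Graph n} {c A} → Separation U H c A →
  Separation (actSubset σ U) (actGraph σ H) (σ ⟨$⟩ʳ c) (actSubset σ A)
separation-act σ {U} {H} {c} {A} (c∈U , A⊆U , A∌c , noX) =
  trans (mem-actSubset σ U _) (trans (cong (mem U) (P.inverseˡ σ)) c∈U) ,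
  (λ j a → trans (mem-actSubset σ U j) (A⊆U _ (trans (sym (mem-actSubset σ A j)) a))) ,
  trans (mem-actSubset σ A _) (trans (cong (mem A) (P.inverseˡ σ)) A∌c) ,
  λ x y → trans (cong₂ (λ a b → a ∧ b) (actGraph-apply σ H x y) (cong₂ (λ a b → a ∧ b) (leftSide-act σ A x) (rightSide-act σ U A c y)))
                (noX (actV⁻¹ σ x) (actV⁻¹ σ y))

separation-resp : ∀ {n} {U U' : Subset n} {H H' : Graph n} {c A} → U ≡ U' → GraphEq H H' → Separation U H c A → Separation U' H' c A
separation-resp {U = U} {H = H} {H'} {c} {A} refl eq (c∈U , A⊆U , A∌c , noX) =
  c∈U , A⊆U , A∌c , λ x y → trans (cong (λ a → a ∧ leftSide A x ∧ rightSide U c A y) (sym (eq x y))) (noX x y)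

Relabelled : ∀ {n} → Permutation′ n → Subset n → Graph n → Subset n → Graph n → Set
Relabelled σ U H U' H' = U' ≡ actSubset σ U × GraphEq H' (actGraph σ H)

Relabelled-flip : ∀ {n} (σ : Permutation′ n) {U H U' H'} → Relabelled σ U H U' H' → Relabelled (P.flip σ) U' H' U H
Relabelled-flip σ {U} {H} {U'} {H'} (refl , geq) =
  lookup-ext (λ i → sym (trans (mem-actSubset (P.flip σ) (actSubset σ U) i) (trans (mem-actSubset σ U _) (cong (mem U) (P.inverseˡ σ))))) ,
  λ u v → sym (trans (actGraph-apply (P.flip σ) H' u v) (trans (geq _ _) (trans (actGraph-apply σ H _ _)
            (cong₂ H (actV⁻¹-flip σ u) (actV⁻¹-flip σ v)))))

sNetwork-relabel : ∀ {n} (σ : Permutation′ n) {U H U' H'} → IsNetwork U' H' → Relabelled σ U H U' H' →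
  IsSNetwork U H → IsSNetwork U' H'
sNetwork-relabel σ {U} {H} {U'} {H'} net' (eU , eH) sn with sNetwork⇒separation sn
... | c , A , s = separation⇒sNetwork {U = U'} {H = H'} net' {σ ⟨$⟩ʳ c} {actSubset σ A} (separation-resp {U = actSubset σ U} {U'} {actGraph σ H} {H'} {σ ⟨$⟩ʳ c} {actSubset σ A} (sym eU) (λ u v → sym (eH u v)) (separation-act σ {U} {H} {c} {A} s))

sNetwork-unrelabel : ∀ {n} (σ : Permutation′ n) {U H U' H'} → IsNetwork U H → Relabelled σ U H U' H' →
  IsSNetwork U' H' → IsSNetwork U H
sNetwork-unrelabel σ {U} {H} {U'} {H'} net r = sNetwork-relabel (P.flip σ) {U'} {H'} {U} {H} net (Relabelled-flip σ {U} {H} {U'} {H'} r)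

embM-act : ∀ {n} (σ : Permutation′ n) c u → actV⁻¹ σ (embM (σ ⟨$⟩ʳ c) u) ≡ embM c (actV⁻¹ σ u)
embM-act σ c p0 = refl
embM-act σ c p1 = cong int (P.inverseˡ σ)
embM-act σ c (int i) = refl

embN-act : ∀ {n} (σ : Permutation′ n) c u → actV⁻¹ σ (embN (σ ⟨$⟩ʳ c) u) ≡ embN c (actV⁻¹ σ u)
embN-act σ c p0 = cong int (P.inverseˡ σ)
embN-act σ c p1 = refl
embN-act σ c (int i) = refl

leftFactor-act : ∀ {n} (σ : Permutation′ n) c A {H H' : Graph n} → GraphEq H' (actGraph σ H) →
  GraphEq (leftFactor (σ ⟨$⟩ʳ c) (actSubset σ A) H') (actGraph σ (leftFactor c A H))
leftFactor-act σ c A {H} {H'} eq u v =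
  trans (cong₂ (λ a b → a ∧ b) (activeB-act σ A u) (cong₂ (λ a b → a ∧ b) (activeB-act σ A v)
          (trans (eq _ _) (trans (actGraph-apply σ H _ _) (cong₂ H (embM-act σ c u) (embM-act σ c v))))))
        (sym (actGraph-apply σ (leftFactor c A H) u v))

rightFactor-act : ∀ {n} (σ : Permutation′ n) c B {H H' : Graph n} → GraphEq H' (actGraph σ H) →
  GraphEq (rightFactor (σ ⟨$⟩ʳ c) (actSubset σ B) H') (actGraph σ (rightFactor c B H))
rightFactor-act σ c B {H} {H'} eq u v =
  trans (cong₂ (λ a b → a ∧ b) (activeB-act σ B u) (cong₂ (λ a b → a ∧ b) (activeB-act σ B v)
          (trans (eq _ _) (trans (actGraph-apply σ H _ _) (cong₂ H (embN-act σ c u) (embN-act σ c v))))))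
        (sym (actGraph-apply σ (rightFactor c B H) u v))

rightFactor-cong : ∀ {n} c {B B' : Subset n} {H : Graph n} → B ≡ B' → GraphEq (rightFactor c B H) (rightFactor c B' H)
rightFactor-cong c refl u v = refl

rightPart-act : ∀ {n} (σ : Permutation′ n) U c A → rightPart (actSubset σ U) (σ ⟨$⟩ʳ c) (actSubset σ A) ≡ actSubset σ (rightPart U c A)
rightPart-act σ U c A = lookup-ext λ j →
  trans (mem-tabulate _ j) (trans (cong₂ (λ a b → a ∧ b) (mem-actSubset σ U j) (cong₂ (λ a b → not a ∧ not b) (mem-actSubset σ A j) (eqF-act σ j c)))
    (sym (trans (mem-actSubset σ (rightPart U c A) j) (mem-tabulate (λ i → mem U i ∧ not (mem A i) ∧ not (eqF i c)) (σ ⟨$⟩ˡ j)))))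

full-act : ∀ {n} (σ : Permutation′ n) → full ≡ actSubset σ full
full-act σ = lookup-ext λ j → trans (mem-tabulate _ j) (sym (trans (mem-actSubset σ full j) (mem-tabulate (λ _ → true) (σ ⟨$⟩ˡ j))))

unembM : ∀ {n} → Fin n → V n → V n
unembM p p0 = p0
unembM p p1 = int p
unembM p (int i) = if eqF i p then p1 else int i

unembN : ∀ {n} → Fin n → V n → V n
unembN p p0 = int p
unembN p p1 = p1
unembN p (int i) = if eqF i p then p0 else int i

seriesGraph : ∀ {n} → Fin n → Graph n → Graph n → Graph n
seriesGraph p R0 R1 u v = R0 (unembM p u) (unembM p v) ∨ R1 (unembN p u) (unembN p v)

seriesSet : ∀ {n} → Fin n → Subset n → Subset n → Subset n
seriesSet p A0 A1 = tabulate (λ i → eqF i p ∨ mem A0 i ∨ mem A1 i)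

eqF-outside : ∀ {n} {A : Subset n} {p i} → mem A p ≡ false → mem A i ≡ true → eqF i p ≡ false
eqF-outside {A = A} Ap Ai = ≢true⇒≡false λ e → ≡false⇒≢true Ap (subst (λ z → mem A z ≡ true) (eqF⇒≡ e) Ai)

unembM-embM : ∀ {n} {A : Subset n} {p} → mem A p ≡ false → ∀ a → Active A a → unembM p (embM p a) ≡ a
unembM-embM Ap p0 _ = refl
unembM-embM {p = p} Ap p1 _ rewrite eqF-diag p = refl
unembM-embM {A = A} Ap (int i) a rewrite eqF-outside {A = A} Ap a = refl

embM-unembM : ∀ {n} {A : Subset n} {p} → mem A p ≡ false → ∀ u → Active A (unembM p u) → embM p (unembM p u) ≡ u
embM-unembM Ap p0 _ = refl
embM-unembM Ap p1 a = ⊥-elim (≡false⇒≢true Ap a)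
embM-unembM {p = p} Ap (int i) a with eqF i p in e
... | true = cong int (sym (eqF⇒≡ e))
... | false = refl

unembN-embN : ∀ {n} {A : Subset n} {p} → mem A p ≡ false → ∀ a → Active A a → unembN p (embN p a) ≡ a
unembN-embN Ap p1 _ = refl
unembN-embN {p = p} Ap p0 _ rewrite eqF-diag p = refl
unembN-embN {A = A} Ap (int i) a rewrite eqF-outside {A = A} Ap a = refl

embN-unembN : ∀ {n} {A : Subset n} {p} → mem A p ≡ false → ∀ u → Active A (unembN p u) → embN p (unembN p u) ≡ u
embN-unembN Ap p1 _ = refl
embN-unembN Ap p0 a = ⊥-elim (≡false⇒≢true Ap a)
embN-unembN {p = p} Ap (int i) a with eqF i p in e
... | true = cong int (sym (eqF⇒≡ e))
... | false = refl

seriesGraph-isSeriesComp : ∀ {n} {A0 A1 : Subset n} {R0 R1 : Graph n} {p} → IsNetwork A0 R0 → IsNetwork A1 R1 →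
  mem A0 p ≡ false → mem A1 p ≡ false → IsSeriesComp p R0 R1 (seriesGraph p R0 R1)
seriesGraph-isSeriesComp {A0 = A0} {A1} {R0} {R1} {p} n0 n1 A0p A1p u v = mk⇔ to from
  where
  module N0 = NetworkFacts n0
  module N1 = NetworkFacts n1
  to : Edge (seriesGraph p R0 R1) u v → SeriesEdge p R0 R1 u v
  to e with ∨-elim {R0 (unembM p u) (unembM p v)} e
  ... | inj₁ r with N0.edge-active _ _ r
  ...   | au , av = inj₁ (unembM p u , unembM p v , embM-unembM {A = A0} A0p u au , embM-unembM {A = A0} A0p v av , r)
  to e | inj₂ r with N1.edge-active _ _ r
  ...   | au , av = inj₂ (unembN p u , unembN p v , embN-unembN {A = A1} A1p u au , embN-unembN {A = A1} A1p v av , r)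
  from : SeriesEdge p R0 R1 u v → Edge (seriesGraph p R0 R1) u v
  from (inj₁ (a , b , refl , refl , m)) with N0.edge-active a b m
  ... | aa , ab = ∨-introˡ (subst (λ z → R0 z (unembM p (embM p b)) ≡ true) (sym (unembM-embM {A = A0} A0p a aa))
                        (subst (λ z → R0 a z ≡ true) (sym (unembM-embM {A = A0} A0p b ab)) m))
  from (inj₂ (a , b , refl , refl , m)) with N1.edge-active a b m
  ... | aa , ab = ∨-introʳ {R0 (unembM p (embN p a)) (unembM p (embN p b))}
                       (subst (λ z → R1 z (unembN p (embN p b)) ≡ true) (sym (unembN-embN {A = A1} A1p a aa))
                        (subst (λ z → R1 a z ≡ true) (sym (unembN-embN {A = A1} A1p b ab)) m))

decomposition⇒seriesGraph : ∀ {n} {U : Subset n} {G : Graph n} {c : Fin n} {A : Subset n} {M : Graph n} {B : Subset n} {N : Graph n} →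
  IsSeriesDecomposition U G c A M B N → GraphEq (seriesGraph c M N) G
decomposition⇒seriesGraph {U = U} {G} {c} {A} {M} {B} {N} d u v =
  ≡true-ext (λ e → Equivalence.from (D.comp u v) (Equivalence.to (ok u v) e))
          (λ e → Equivalence.from (ok u v) (Equivalence.to (D.comp u v) e))
  where
  module D = DecompositionFacts {U = U} {G} {c} {A} {M} {B} {N} d
  ok : IsSeriesComp c M N (seriesGraph c M N)
  ok = seriesGraph-isSeriesComp {A0 = A} {B} {M} {N} {c} (proj₁ D.ntM) (proj₁ D.ntN) D.c∉A D.c∉B

unembM-act : ∀ {n} (σ : Permutation′ n) p u → actV⁻¹ σ (unembM (σ ⟨$⟩ʳ p) u) ≡ unembM p (actV⁻¹ σ u)
unembM-act σ p p0 = refl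
unembM-act σ p p1 = cong int (P.inverseˡ σ)
unembM-act σ p (int j) rewrite eqF-act σ j p with eqF (σ ⟨$⟩ˡ j) p
... | true = refl
... | false = refl

unembN-act : ∀ {n} (σ : Permutation′ n) p u → actV⁻¹ σ (unembN (σ ⟨$⟩ʳ p) u) ≡ unembN p (actV⁻¹ σ u)
unembN-act σ p p1 = refl
unembN-act σ p p0 = cong int (P.inverseˡ σ)
unembN-act σ p (int j) rewrite eqF-act σ j p with eqF (σ ⟨$⟩ˡ j) p
... | true = refl
... | false = refl

seriesGraph-act : ∀ {n} (σ : Permutation′ n) p {R0 R1 R0' R1' : Graph n} →
  GraphEq R0' (actGraph σ R0) → GraphEq R1' (actGraph σ R1) →
  GraphEq (seriesGraph (σ ⟨$⟩ʳ p) R0' R1') (actGraph σ (seriesGraph p R0 R1))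
seriesGraph-act σ p {R0} {R1} {R0'} {R1'} e0 e1 u v =
  trans (cong₂ _∨_ (trans (e0 _ _) (trans (actGraph-apply σ R0 _ _) (cong₂ R0 (unembM-act σ p u) (unembM-act σ p v))))
                   (trans (e1 _ _) (trans (actGraph-apply σ R1 _ _) (cong₂ R1 (unembN-act σ p u) (unembN-act σ p v)))))
        (sym (actGraph-apply σ (seriesGraph p R0 R1) u v))

seriesSet-act : ∀ {n} (σ : Permutation′ n) p A0 A1 → seriesSet (σ ⟨$⟩ʳ p) (actSubset σ A0) (actSubset σ A1) ≡ actSubset σ (seriesSet p A0 A1)
seriesSet-act σ p A0 A1 = lookup-ext λ j →
  trans (mem-tabulate _ j) (trans (cong₂ _∨_ (eqF-act σ j p) (cong₂ _∨_ (mem-actSubset σ A0 j) (mem-actSubset σ A1 j)))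
    (sym (trans (mem-actSubset σ (seriesSet p A0 A1) j) (mem-tabulate (λ i → eqF i p ∨ mem A0 i ∨ mem A1 i) (σ ⟨$⟩ˡ j)))))

ind-inj : ∀ {a b} → ind a ≡ ind b → a ≡ b
ind-inj {false} {false} _ = refl
ind-inj {true} {true} _ = refl
ind-inj {false} {true} ()
ind-inj {true} {false} ()

ind-∨₃ : ∀ a b d → ind a + ind b + ind d ≤ 1 → ind (a ∨ b ∨ d) ≡ ind a + ind b + ind d
ind-∨₃ false false false _ = refl
ind-∨₃ false false true _ = refl
ind-∨₃ false true false _ = refl
ind-∨₃ true false false _ = refl
ind-∨₃ false true true (s≤s ())
ind-∨₃ true false true (s≤s ())
ind-∨₃ true true false (s≤s ())
ind-∨₃ true true true (s≤s ())

seriesSet-split : ∀ {n} p (A0 A1 : Subset n) → (∀ i → ind (eqF i p) + ind (mem A0 i) + ind (mem A1 i) ≤ 1) →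
  IsSplit (seriesSet p A0 A1) p A0 A1
seriesSet-split p A0 A1 h i = sym (trans (cong ind (mem-tabulate (λ i → eqF i p ∨ mem A0 i ∨ mem A1 i) i)) (ind-∨₃ (eqF i p) (mem A0 i) (mem A1 i) (h i)))

split⇒seriesSet : ∀ {n} {U : Subset n} {c A B} → IsSplit U c A B → seriesSet c A B ≡ U
split⇒seriesSet {U = U} {c} {A} {B} sp = lookup-ext λ i → ind-inj (trans (cong ind (mem-tabulate (λ i → eqF i c ∨ mem A i ∨ mem B i) i))
  (trans (ind-∨₃ (eqF i c) (mem A i) (mem B i) (subst (λ z → z ≤ 1) (sym (sp i)) (ind≤1 (mem U i)))) (sp i)))

Block : ℕ → Set
Block n = Subset n × Graph n

occurrences : ∀ {n} → Fin n → List (Block n) → ℕ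
occurrences i = countB (λ b → mem (proj₁ b) i)

+-regroup : ∀ a x b d r → a + x + (b + (d + r)) ≡ x + ((a + b + d) + r)
+-regroup = solve 5 (λ a x b d r → a :+ x :+ (b :+ (d :+ r)) := x :+ ((a :+ b :+ d) :+ r)) refl

index-after-split : ∀ m → suc (suc (suc (m + m))) ≡ suc (suc m + suc m)
index-after-split m = cong (λ z → suc (suc z)) (sym (ℕP.+-suc m m))

index-after-join : ∀ m → suc (m + suc m) ≡ suc (suc (m + m))
index-after-join m = cong suc (ℕP.+-suc m m)

NetEq-refl : ∀ {n} {b : Block n} → NetEq b b
NetEq-refl = refl , λ _ _ → refl

NetEq-sym : ∀ {n} {b b′ : Block n} → NetEq b b′ → NetEq b′ b
NetEq-sym (e , g) = sym e , λ u v → sym (g u v)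

NetEq-trans : ∀ {n} {b b′ b″ : Block n} → NetEq b b′ → NetEq b′ b″ → NetEq b b″
NetEq-trans (e , g) (e′ , g′) = trans e e′ , λ u v → trans (g u v) (g′ u v)

ChainEq-sym : ∀ {n} {ch ch′ : Chain n} → ChainEq ch ch′ → ChainEq ch′ ch
ChainEq-sym (e , bs) = sym e , Pw.symmetric NetEq-sym bs

ChainEq-trans : ∀ {n} {ch ch′ ch″ : Chain n} → ChainEq ch ch′ → ChainEq ch′ ch″ → ChainEq ch ch″
ChainEq-trans (e , bs) (e′ , bs′) = trans e e′ , Pw.transitive NetEq-trans bs bs′

RawLEq-sym : ∀ {n} {x y : RawL n} → RawLEq x y → RawLEq y x
RawLEq-sym {x = inj₁ _} {inj₁ _} e u v = sym (e u v)
RawLEq-sym {x = inj₂ _} {inj₂ _} e = ChainEq-sym e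

RawLEq-trans : ∀ {n} {x y z : RawL n} → RawLEq x y → RawLEq y z → RawLEq x z
RawLEq-trans {x = inj₁ _} {inj₁ _} {inj₁ _} e e′ u v = trans (e u v) (e′ u v)
RawLEq-trans {x = inj₂ _} {inj₂ _} {inj₂ _} e e′ = ChainEq-trans e e′

actV⁻¹-id : ∀ {n} (u : V n) → actV⁻¹ P.id u ≡ u
actV⁻¹-id p0 = refl
actV⁻¹-id p1 = refl
actV⁻¹-id (int j) = refl

actGraph-id : ∀ {n} (G : Graph n) → GraphEq G (actGraph P.id G)
actGraph-id G u v = sym (trans (actGraph-apply P.id G u v) (cong₂ G (actV⁻¹-id u) (actV⁻¹-id v)))

actNet-id : ∀ {n} (bs : List (Block n)) → Pointwise NetEq bs (map (actNet P.id) bs)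
actNet-id [] = []
actNet-id ((A , G) ∷ bs) = (lookup-ext (λ i → sym (mem-actSubset P.id A i)) , actGraph-id G) ∷ actNet-id bs

actChain-id : ∀ {n} (ch : Chain n) → ChainEq ch (actChain P.id ch)
actChain-id (chain us bs) = sym (LP.map-id us) , actNet-id bs

actRawL-id : ∀ {n} (x : RawL n) → RawLEq x (actRawL P.id x)
actRawL-id (inj₁ G) = actGraph-id G
actRawL-id (inj₂ ch) = actChain-id ch

splitChain : ∀ {n} → Subset n → Graph n → Fin n → Subset n → List (Fin n) → List (Block n) → Chain n
splitChain U R c A us rest =
  chain (c ∷ us) ((A , leftFactor c A R) ∷ (rightPart U c A , rightFactor c (rightPart U c A) R) ∷ rest)

joinChain : ∀ {n} → Fin n → List (Fin n) → Block n → Block n → List (Block n) → Chain n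
joinChain p us (A , M) (B , N) rest = chain us ((seriesSet p A B , seriesGraph p M N) ∷ rest)

canonicalChain : ∀ {n} (U : Subset n) (R : Graph n) → CanonicalSplit U R → List (Fin n) → List (Block n) → Chain n
canonicalChain U R cs = splitChain U R (proj₁ cs) (proj₁ (proj₂ cs))

join-split : ∀ {n} {U : Subset n} {R : Graph n} (net : IsNetwork U R) {c A} (s : Separation U R c A) us rest →
  ChainEq (joinChain c us (A , leftFactor c A R) (rightPart U c A , rightFactor c (rightPart U c A) R) rest)
          (chain us ((U , R) ∷ rest))
join-split {U = U} {R} net {c} {A} s us rest =
  refl ,
  (split⇒seriesSet {U = U} {c} {A} {rightPart U c A} (Factors.split) ,
   decomposition⇒seriesGraph {U = U} {R} {c} {A} {leftFactor c A R} {rightPart U c A} {rightFactor c (rightPart U c A) R}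
     Factors.decomposition) ∷ Pw.refl NetEq-refl
  where
  module Factors = FactorsOfSeparation {U = U} {R} net {c} {A} s

split-join : ∀ {n} {U : Subset n} {p A M B N} → IsSeriesDecomposition U (seriesGraph p M N) p A M B N →
  ¬ IsSNetwork A M → IsNetwork U (seriesGraph p M N) → (cs : CanonicalSplit U (seriesGraph p M N)) → ∀ us rest →
  ChainEq (canonicalChain U (seriesGraph p M N) cs us rest) (chain (p ∷ us) ((A , M) ∷ (B , N) ∷ rest))
split-join {U = U} {p} {A} {M} {B} {N} d ¬sM net (c , A′ , s , ¬sM′) us rest
  with canonical-decomposition-unique {U = U} {seriesGraph p M N} {c} {A′} {leftFactor c A′ (seriesGraph p M N)}
         {rightPart U c A′} {rightFactor c (rightPart U c A′) (seriesGraph p M N)} {p} {A} {M} {B} {N}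
         (FactorsOfSeparation.decomposition {U = U} {seriesGraph p M N} net {c} {A′} s) d ¬sM′ ¬sM
... | c≡p , A′≡A , M′≡M , B′≡B , N′≡N = cong (_∷ us) c≡p , (A′≡A , M′≡M) ∷ (B′≡B , N′≡N) ∷ Pw.refl NetEq-refl

canonicalChain-natural : ∀ {n} (σ : Permutation′ n) {U R U′ R′} (net : IsNetwork U R) (net′ : IsNetwork U′ R′)
  (cs : CanonicalSplit U R) (cs′ : CanonicalSplit U′ R′) {us us′ rest rest′} →
  us′ ≡ map (σ ⟨$⟩ʳ_) us → U′ ≡ actSubset σ U → GraphEq R′ (actGraph σ R) →
  Pointwise NetEq rest′ (map (actNet σ) rest) →
  ChainEq (canonicalChain U′ R′ cs′ us′ rest′) (actChain σ (canonicalChain U R cs us rest))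
canonicalChain-natural σ {U} {R} {U′} {R′} net net′ (c , A , s , ¬sM) (c′ , A′ , s′ , ¬sM′) us-eq U-eq R-eq rest-eq
  with canonical-decomposition-unique {U = U′} {R′} {c′} {A′} {leftFactor c′ A′ R′} {rightPart U′ c′ A′}
         {rightFactor c′ (rightPart U′ c′ A′) R′} {σ ⟨$⟩ʳ c} {actSubset σ A} {leftFactor (σ ⟨$⟩ʳ c) (actSubset σ A) R′}
         {rightPart U′ (σ ⟨$⟩ʳ c) (actSubset σ A)} {rightFactor (σ ⟨$⟩ʳ c) (rightPart U′ (σ ⟨$⟩ʳ c) (actSubset σ A)) R′}
         (FactorsOfSeparation.decomposition {U = U′} {R′} net′ {c′} {A′} s′)
         (FactorsOfSeparation.decomposition {U = U′} {R′} net′ {σ ⟨$⟩ʳ c} {actSubset σ A} sσ) ¬sM′ ¬sMσ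
  where
  sσ : Separation U′ R′ (σ ⟨$⟩ʳ c) (actSubset σ A)
  sσ = separation-resp {U = actSubset σ U} {U′} {actGraph σ R} {R′} (sym U-eq) (λ u v → sym (R-eq u v)) (separation-act σ {U} {R} {c} {A} s)
  ¬sMσ : ¬ IsSNetwork (actSubset σ A) (leftFactor (σ ⟨$⟩ʳ c) (actSubset σ A) R′)
  ¬sMσ sMσ = ¬sM (sNetwork-unrelabel σ {A} {leftFactor c A R} {actSubset σ A} {leftFactor (σ ⟨$⟩ʳ c) (actSubset σ A) R′}
                   (FactorsOfSeparation.leftFactor-isNetwork {U = U} {R} net {c} {A} s)
                   (refl , leftFactor-act σ c A {R} {R′} R-eq) sMσ)
... | c-eq , A-eq , M-eq , B-eq , N-eq =
  cong₂ _∷_ c-eq us-eq ,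
  (A-eq , λ u v → trans (M-eq u v) (leftFactor-act σ c A {R} {R′} R-eq u v)) ∷
  (trans B-eq rightPartσ , λ u v → trans (N-eq u v) (trans (rightFactor-cong (σ ⟨$⟩ʳ c) {H = R′} rightPartσ u v)
                                                           (rightFactor-act σ c (rightPart U c A) {R} {R′} R-eq u v))) ∷
  rest-eq
  where
  rightPartσ : rightPart U′ (σ ⟨$⟩ʳ c) (actSubset σ A) ≡ actSubset σ (rightPart U c A)
  rightPartσ = trans (cong (λ X → rightPart X (σ ⟨$⟩ʳ c) (actSubset σ A)) U-eq) (rightPart-act σ U c A)

joinChain-natural : ∀ {n} (σ : Permutation′ n) {p p′ us us′ A M B N A′ M′ B′ N′} {rest rest′ : List (Block n)} →
  p′ ≡ σ ⟨$⟩ʳ p → us′ ≡ map (σ ⟨$⟩ʳ_) us → A′ ≡ actSubset σ A → GraphEq M′ (actGraph σ M) →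
  B′ ≡ actSubset σ B → GraphEq N′ (actGraph σ N) → Pointwise NetEq rest′ (map (actNet σ) rest) →
  ChainEq (joinChain p′ us′ (A′ , M′) (B′ , N′) rest′) (actChain σ (joinChain p us (A , M) (B , N) rest))
joinChain-natural σ {p} {A = A} {M} {B} {N} {M′ = M′} {N′ = N′} refl us-eq refl M-eq refl N-eq rest-eq =
  us-eq , (seriesSet-act σ p A B , seriesGraph-act σ p {M} {N} {M′} {N′} M-eq N-eq) ∷ rest-eq

FirstIsS : ∀ {n} → Chain n → Set
FirstIsS (chain _ []) = ⊤
FirstIsS (chain _ ((U , R) ∷ _)) = IsSNetwork U R

module ClosedSpecies (ℛ : NetSpecies) (species : IsSpeciesOfNonTrivialNetworks ℛ) (closed : ClosedUnderSeries ℛ) where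

  nonTrivial : ∀ {n A G} → ℛ n A G → NonTrivialNetwork A G
  nonTrivial {n} {A} {G} = proj₁ species n A G

  network : ∀ {n A G} → ℛ n A G → IsNetwork A G
  network r = proj₁ (nonTrivial r)

  sNetwork⇔seriesProduct : ∀ n G → SNets ℛ n full G ⇔ InSeriesProduct (Minus ℛ (SNets ℛ)) ℛ n full G
  sNetwork⇔seriesProduct n G = mk⇔ to from
    where
    to : SNets ℛ n full G → InSeriesProduct (Minus ℛ (SNets ℛ)) ℛ n full G
    to (r , sn) with canonical-split (network r) sn
    ... | c , A , s , ¬sM = c , A , _ , _ , _ , split , (proj₁ factors , λ sM → ¬sM (proj₂ sM)) , proj₂ factors , series
      where
      open FactorsOfSeparation {U = full} {G} (network r) {c} {A} s
      factors : ℛ n A (leftFactor c A G) × ℛ n B1 N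
      factors = Equivalence.to (closed n full G c A M B1 N decomposition) r
    from : InSeriesProduct (Minus ℛ (SNets ℛ)) ℛ n full G → SNets ℛ n full G
    from (c , A , M , B , N , split , (rM , _) , rN , series) =
      Equivalence.from (closed n full G c A M B N d) (rM , rN) , (c , A , M , B , N , d)
      where
      d : IsSeriesDecomposition full G c A M B N
      d = split , nonTrivial rM , nonTrivial rN , series

  seriesProduct-canonical : IsCanonical (Minus ℛ (SNets ℛ)) ℛ
  seriesProduct-canonical n G c A M B N c′ A′ M′ B′ N′ (split , (rM , ¬sM) , rN , series) (split′ , (rM′ , ¬sM′) , rN′ , series′)
    with canonical-decomposition-unique {U = full} {G} {c} {A} {M} {B} {N} {c′} {A′} {M′} {B′} {N′}
           (split , nonTrivial rM , nonTrivial rN , series) (split′ , nonTrivial rM′ , nonTrivial rN′ , series′)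
           (λ sM → ¬sM (rM , sM)) (λ sM′ → ¬sM′ (rM′ , sM′))
  ... | c≡c′ , A≡A′ , M≡M′ , B≡B′ , N≡N′ = c≡c′ , (A≡A′ , M≡M′) , (B≡B′ , N≡N′)

  FirstIsS? : ∀ {n k} (ch : Chain n) → IsXRChain ℛ n k ch → Dec (FirstIsS ch)
  FirstIsS? (chain _ []) _ = yes tt
  FirstIsS? (chain _ (_ ∷ _)) (_ , _ , _ , r ∷ _) = sNetwork? (network r)

  FirstIsS-relabel : ∀ {n} (σ : Permutation′ n) {k k′} (ch : Chain n) → IsXRChain ℛ n k ch →
    (ch′ : Chain n) → IsXRChain ℛ n k′ ch′ → ChainEq ch′ (actChain σ ch) → FirstIsS ch ⇔ FirstIsS ch′
  FirstIsS-relabel σ (chain _ []) _ (chain _ []) _ _ = mk⇔ (λ x → x) (λ x → x)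
  FirstIsS-relabel σ (chain _ ((U , R) ∷ _)) (_ , _ , _ , r ∷ _) (chain _ ((U′ , R′) ∷ _)) (_ , _ , _ , r′ ∷ _) (_ , eq ∷ _) =
    mk⇔ (sNetwork-relabel σ {U} {R} {U′} {R′} (network r′) eq) (sNetwork-unrelabel σ {U} {R} {U′} {R′} (network r) eq)

  singleton-isXRChain : ∀ {n} (G : Graph n) → ℛ n full G → IsXRChain ℛ n 0 (chain [] ((full , G) ∷ []))
  singleton-isXRChain G r = refl , refl , (λ i → cong (λ z → ind z + 0) (mem-tabulate (λ _ → true) i)) , r ∷ All.[]

  splitChain-isXRChain : ∀ {n k} {U : Subset n} {R c A} us rest → Separation U R c A →
    IsXRChain ℛ n k (chain us ((U , R) ∷ rest)) → IsXRChain ℛ n (suc k) (splitChain U R c A us rest)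
  splitChain-isXRChain {n} {U = U} {R} {c} {A} us rest s (len-us , len-bs , once , r ∷ rs) =
    cong suc len-us , cong suc len-bs , once′ , proj₁ factors ∷ proj₂ factors ∷ rs
    where
    open FactorsOfSeparation (network r) s using (split; decomposition)
    factors : ℛ n A (leftFactor c A R) × ℛ n (rightPart U c A) (rightFactor c (rightPart U c A) R)
    factors = Equivalence.to (closed n U R c A _ _ _ decomposition) r
    once′ : ∀ i → occ i (splitChain U R c A us rest) ≡ 1
    once′ i = trans (+-regroup (ind (eqF i c)) (countB (eqF i) us) (ind (mem A i)) (ind (mem (rightPart U c A) i))
                               (occurrences i rest))
                    (trans (cong (λ z → countB (eqF i) us + (z + occurrences i rest)) (split i)) (once i))

  canonicalChain-isXRChain : ∀ {n k} {U : Subset n} {R} (cs : CanonicalSplit U R) us rest →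
    IsXRChain ℛ n k (chain us ((U , R) ∷ rest)) → IsXRChain ℛ n (suc k) (canonicalChain U R cs us rest)
  canonicalChain-isXRChain cs us rest = splitChain-isXRChain us rest (proj₁ (proj₂ (proj₂ cs)))

  module Join {n k} (p : Fin n) (us : List (Fin n)) {A M B N} (rest : List (Block n))
    (pr : IsXRChain ℛ n (suc k) (chain (p ∷ us) ((A , M) ∷ (B , N) ∷ rest))) where

    private
      rM : ℛ n A M
      rM = All.head (proj₂ (proj₂ (proj₂ pr)))
      rN : ℛ n B N
      rN = All.head (All.tail (proj₂ (proj₂ (proj₂ pr))))
      once : ∀ i → countB (eqF i) us + ((ind (eqF i p) + ind (mem A i) + ind (mem B i)) + occurrences i rest) ≡ 1
      once i = trans (sym (+-regroup (ind (eqF i p)) (countB (eqF i) us) (ind (mem A i)) (ind (mem B i))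
                                     (occurrences i rest)))
                     (proj₁ (proj₂ (proj₂ pr)) i)
      at-most-once : ∀ i → ind (eqF i p) + ind (mem A i) + ind (mem B i) ≤ 1
      at-most-once i = subst (ind (eqF i p) + ind (mem A i) + ind (mem B i) ≤_) (once i)
        (ℕP.≤-trans (ℕP.m≤m+n _ (occurrences i rest)) (ℕP.m≤n+m _ (countB (eqF i) us)))

    split : IsSplit (seriesSet p A B) p A B
    split = seriesSet-split p A B at-most-once

    decomposition : IsSeriesDecomposition (seriesSet p A B) (seriesGraph p M N) p A M B N
    decomposition = split , nonTrivial rM , nonTrivial rN ,
                    seriesGraph-isSeriesComp (network rM) (network rN) (SplitFacts.c∉A {U = seriesSet p A B} {p} {A} {B} split)
                      (SplitFacts.c∉B {U = seriesSet p A B} {p} {A} {B} split)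

    joined∈ℛ : ℛ n (seriesSet p A B) (seriesGraph p M N)
    joined∈ℛ = Equivalence.from (closed n _ _ p A M B N decomposition) (rM , rN)

    joined-sNetwork : IsSNetwork (seriesSet p A B) (seriesGraph p M N)
    joined-sNetwork = p , A , M , B , N , decomposition

    isXRChain : IsXRChain ℛ n k (joinChain p us (A , M) (B , N) rest)
    isXRChain = ℕP.suc-injective (proj₁ pr) , ℕP.suc-injective (proj₁ (proj₂ pr)) ,
      (λ i → trans (cong (λ z → countB (eqF i) us + (z + occurrences i rest)) (sym (split i))) (once i)) ,
      joined∈ℛ ∷ All.tail (All.tail (proj₂ (proj₂ (proj₂ pr))))

  -- A join of a one-point chain covers every label, so it is a network on the full label set.
  module JoinToFull {n} (p : Fin n) {A M B N}
    (pr : IsXRChain ℛ n 1 (chain (p ∷ []) ((A , M) ∷ (B , N) ∷ []))) where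

    open Join p [] [] pr

    seriesSet≡full : seriesSet p A B ≡ full
    seriesSet≡full = lookup-ext λ i →
      trans (ind≡1⇒true (trans (sym (ℕP.+-identityʳ _)) (proj₁ (proj₂ (proj₂ isXRChain)) i)))
            (sym (mem-tabulate (λ _ → true) i))

    joined∈ℛ′ : ℛ n full (seriesGraph p M N)
    joined∈ℛ′ = subst (λ X → ℛ n X (seriesGraph p M N)) seriesSet≡full joined∈ℛ

    joined-sNetwork′ : IsSNetwork full (seriesGraph p M N)
    joined-sNetwork′ = subst (λ X → IsSNetwork X (seriesGraph p M N)) seriesSet≡full joined-sNetwork

    decomposition′ : IsSeriesDecomposition full (seriesGraph p M N) p A M B N
    decomposition′ = subst (λ X → IsSeriesDecomposition X (seriesGraph p M N) p A M B N) seriesSet≡full decomposition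

  canonicalChainOf : ∀ {n} {U : Subset n} {R} → ℛ n U R → IsSNetwork U R → List (Fin n) → List (Block n) → Chain n
  canonicalChainOf {U = U} {R} r sn = canonicalChain U R (canonical-split (network r) sn)

  f-sNetwork : ∀ {n} → Σ (Graph n) (SNets ℛ n full) → RHS ℛ n
  f-sNetwork (G , r , sn) =
    0 , canonicalChainOf r sn [] [] , canonicalChain-isXRChain (canonical-split (network r) sn) [] [] (singleton-isXRChain G r)

  f-split : ∀ {n} m (ch : Chain n) → IsXRChain ℛ n (suc (suc (m + m))) ch → FirstIsS ch → RHS ℛ n
  f-split m (chain us []) (_ , () , _) _
  f-split m (chain us ((U , R) ∷ rest)) pr@(_ , _ , _ , r ∷ _) sn =
    suc m , canonicalChainOf r sn us rest ,
    subst (λ k → IsXRChain ℛ _ k (canonicalChainOf r sn us rest)) (index-after-split m)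
          (canonicalChain-isXRChain (canonical-split (network r) sn) us rest pr)

  f-join : ∀ {n} m (ch : Chain n) → IsXRChain ℛ n (suc (suc (m + m))) ch → RHS ℛ n
  f-join m (chain us []) (_ , () , _)
  f-join m (chain [] (_ ∷ _)) (() , _)
  f-join m (chain (p ∷ us) (_ ∷ [])) (_ , () , _)
  f-join m (chain (p ∷ us) ((A , M) ∷ (B , N) ∷ rest)) pr = m , joinChain p us (A , M) (B , N) rest , Join.isXRChain p us rest pr

  f-chain : ∀ {n} m (ch : Chain n) → IsXRChain ℛ n (suc (suc (m + m))) ch → Dec (FirstIsS ch) → RHS ℛ n
  f-chain m ch pr (yes sn) = f-split m ch pr sn
  f-chain m ch pr (no _) = f-join m ch pr

  f : ∀ {n} → LHS ℛ n → RHS ℛ n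
  f (inj₁ x) = f-sNetwork x
  f (inj₂ (m , ch , pr)) = f-chain m ch pr (FirstIsS? ch pr)

  g-split : ∀ {n} m (ch : Chain n) → IsXRChain ℛ n (suc (m + m)) ch → FirstIsS ch → LHS ℛ n
  g-split m (chain us []) (_ , () , _) _
  g-split m (chain us ((U , R) ∷ rest)) pr@(_ , _ , _ , r ∷ _) sn =
    inj₂ (m , canonicalChainOf r sn us rest , canonicalChain-isXRChain (canonical-split (network r) sn) us rest pr)

  g-join : ∀ {n} m (ch : Chain n) → IsXRChain ℛ n (suc (m + m)) ch → LHS ℛ n
  g-join m (chain us []) (_ , () , _)
  g-join m (chain [] (_ ∷ _)) (() , _)
  g-join m (chain (p ∷ us) (_ ∷ [])) (_ , () , _)
  g-join zero (chain (p ∷ []) (_ ∷ _ ∷ _ ∷ _)) (_ , () , _)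
  g-join zero (chain (p ∷ _ ∷ _) (_ ∷ _ ∷ _)) (() , _)
  g-join zero (chain (p ∷ []) ((A , M) ∷ (B , N) ∷ [])) pr =
    inj₁ (seriesGraph p M N , JoinToFull.joined∈ℛ′ p pr , JoinToFull.joined-sNetwork′ p pr)
  g-join (suc m) (chain (p ∷ us) ((A , M) ∷ (B , N) ∷ rest)) pr =
    inj₂ (m , joinChain p us (A , M) (B , N) rest ,
          subst (λ k → IsXRChain ℛ _ k (joinChain p us (A , M) (B , N) rest)) (index-after-join m)
                (Join.isXRChain p us rest pr))

  g-chain : ∀ {n} m (ch : Chain n) → IsXRChain ℛ n (suc (m + m)) ch → Dec (FirstIsS ch) → LHS ℛ n
  g-chain m ch pr (yes sn) = g-split m ch pr sn
  g-chain m ch pr (no _) = g-join m ch pr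

  g : ∀ {n} → RHS ℛ n → LHS ℛ n
  g (m , ch , pr) = g-chain m ch pr (FirstIsS? ch pr)


  g∘f-sNetwork : ∀ {n} (G : Graph n) (net : IsNetwork full G) (cs : CanonicalSplit full G) pr
    (d : Dec (FirstIsS (canonicalChain full G cs [] []))) →
    RawLEq (rawL ℛ (g-chain 0 (canonicalChain full G cs [] []) pr d)) (inj₁ G)
  g∘f-sNetwork G net (c , A , s , ¬sM) pr (yes sM) = ⊥-elim (¬sM sM)
  g∘f-sNetwork G net (c , A , s , ¬sM) pr (no _) =
    decomposition⇒seriesGraph {U = full} {G} {c} {A} {leftFactor c A G} {rightPart full c A}
      {rightFactor c (rightPart full c A) G} (FactorsOfSeparation.decomposition {U = full} {G} net {c} {A} s)

  g∘f-split : ∀ {n} m us (U : Subset n) R rest (net : IsNetwork U R) (cs : CanonicalSplit U R) pr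
    (d : Dec (FirstIsS (canonicalChain U R cs us rest))) →
    RawLEq (rawL ℛ (g-chain (suc m) (canonicalChain U R cs us rest) pr d)) (inj₂ (chain us ((U , R) ∷ rest)))
  g∘f-split m us U R rest net (c , A , s , ¬sM) pr (yes sM) = ⊥-elim (¬sM sM)
  g∘f-split m us U R rest net (c , A , s , ¬sM) pr (no _) = join-split net s us rest

  f∘g-split : ∀ {n} m us (U : Subset n) R rest (net : IsNetwork U R) (cs : CanonicalSplit U R) pr
    (d : Dec (FirstIsS (canonicalChain U R cs us rest))) →
    ChainEq (rawR ℛ (f-chain m (canonicalChain U R cs us rest) pr d)) (chain us ((U , R) ∷ rest))
  f∘g-split m us U R rest net (c , A , s , ¬sM) pr (yes sM) = ⊥-elim (¬sM sM)
  f∘g-split m us U R rest net (c , A , s , ¬sM) pr (no _) = join-split net s us rest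

  g∘f-join : ∀ {n} m p us (A : Subset n) M B N rest → ¬ IsSNetwork A M →
    (pr : IsXRChain ℛ n (suc (suc (m + m))) (chain (p ∷ us) ((A , M) ∷ (B , N) ∷ rest)))
    (prJ : IsXRChain ℛ n (suc (m + m)) (joinChain p us (A , M) (B , N) rest))
    (d : Dec (FirstIsS (joinChain p us (A , M) (B , N) rest))) →
    RawLEq (rawL ℛ (g-chain m (joinChain p us (A , M) (B , N) rest) prJ d)) (inj₂ (chain (p ∷ us) ((A , M) ∷ (B , N) ∷ rest)))
  g∘f-join m p us A M B N rest ¬sM pr (_ , _ , _ , r ∷ _) (yes sn) =
    split-join (Join.decomposition p us rest pr) ¬sM (network r) (canonical-split (network r) sn) us rest
  g∘f-join m p us A M B N rest ¬sM pr prJ (no ¬sJ) = ⊥-elim (¬sJ (Join.joined-sNetwork p us rest pr))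

  f∘g-join : ∀ {n} m p us (A : Subset n) M B N rest → ¬ IsSNetwork A M →
    (pr : IsXRChain ℛ n (suc (suc (m + suc m))) (chain (p ∷ us) ((A , M) ∷ (B , N) ∷ rest)))
    (prJ : IsXRChain ℛ n (suc (suc (m + m))) (joinChain p us (A , M) (B , N) rest))
    (d : Dec (FirstIsS (joinChain p us (A , M) (B , N) rest))) →
    ChainEq (rawR ℛ (f-chain m (joinChain p us (A , M) (B , N) rest) prJ d)) (chain (p ∷ us) ((A , M) ∷ (B , N) ∷ rest))
  f∘g-join m p us A M B N rest ¬sM pr (_ , _ , _ , r ∷ _) (yes sn) =
    split-join (Join.decomposition p us rest pr) ¬sM (network r) (canonical-split (network r) sn) us rest
  f∘g-join m p us A M B N rest ¬sM pr prJ (no ¬sJ) = ⊥-elim (¬sJ (Join.joined-sNetwork p us rest pr))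

  g∘f-chain : ∀ {n} m (ch : Chain n) pr (d : Dec (FirstIsS ch)) → RawLEq (rawL ℛ (g (f-chain m ch pr d))) (inj₂ ch)
  g∘f-chain m (chain us []) (_ , () , _) _
  g∘f-chain m (chain us ((U , R) ∷ rest)) pr@(_ , _ , _ , r ∷ _) (yes sn) =
    g∘f-split m us U R rest (network r) cs prS (FirstIsS? (canonicalChain U R cs us rest) prS)
    where
    cs : CanonicalSplit U R
    cs = canonical-split (network r) sn
    prS : IsXRChain ℛ _ (suc (suc m + suc m)) (canonicalChain U R cs us rest)
    prS = subst (λ k → IsXRChain ℛ _ k (canonicalChain U R cs us rest)) (index-after-split m)
                (canonicalChain-isXRChain cs us rest pr)
  g∘f-chain m (chain [] (_ ∷ _)) (() , _) (no _)
  g∘f-chain m (chain (p ∷ us) (_ ∷ [])) (_ , () , _) (no _)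
  g∘f-chain m (chain (p ∷ us) ((A , M) ∷ (B , N) ∷ rest)) pr (no ¬sM) =
    g∘f-join m p us A M B N rest ¬sM pr prJ (FirstIsS? (joinChain p us (A , M) (B , N) rest) prJ)
    where
    prJ : IsXRChain ℛ _ (suc (m + m)) (joinChain p us (A , M) (B , N) rest)
    prJ = Join.isXRChain p us rest pr

  g∘f : ∀ {n} (x : LHS ℛ n) → RawLEq (rawL ℛ (g (f x))) (rawL ℛ x)
  g∘f (inj₁ (G , r , sn)) = g∘f-sNetwork G (network r) cs prS (FirstIsS? (canonicalChain full G cs [] []) prS)
    where
    cs : CanonicalSplit full G
    cs = canonical-split (network r) sn
    prS : IsXRChain ℛ _ 1 (canonicalChain full G cs [] [])
    prS = canonicalChain-isXRChain cs [] [] (singleton-isXRChain G r)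
  g∘f (inj₂ (m , ch , pr)) = g∘f-chain m ch pr (FirstIsS? ch pr)

  f∘g-chain : ∀ {n} m (ch : Chain n) pr (d : Dec (FirstIsS ch)) → ChainEq (rawR ℛ (f (g-chain m ch pr d))) ch
  f∘g-chain m (chain us []) (_ , () , _) _
  f∘g-chain m (chain us ((U , R) ∷ rest)) pr@(_ , _ , _ , r ∷ _) (yes sn) =
    f∘g-split m us U R rest (network r) cs prS (FirstIsS? (canonicalChain U R cs us rest) prS)
    where
    cs : CanonicalSplit U R
    cs = canonical-split (network r) sn
    prS : IsXRChain ℛ _ (suc (suc (m + m))) (canonicalChain U R cs us rest)
    prS = canonicalChain-isXRChain cs us rest pr
  f∘g-chain m (chain [] (_ ∷ _)) (() , _) (no _)
  f∘g-chain m (chain (p ∷ us) (_ ∷ [])) (_ , () , _) (no _)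
  f∘g-chain zero (chain (p ∷ []) ((A , M) ∷ (B , N) ∷ [])) pr (no ¬sM) =
    split-join decomposition′ ¬sM (network joined∈ℛ′) (canonical-split (network joined∈ℛ′) joined-sNetwork′) [] []
    where open JoinToFull p pr
  f∘g-chain zero (chain (p ∷ []) (_ ∷ _ ∷ _ ∷ _)) (_ , () , _) (no _)
  f∘g-chain zero (chain (p ∷ _ ∷ _) (_ ∷ _ ∷ _)) (() , _) (no _)
  f∘g-chain (suc m) (chain (p ∷ us) ((A , M) ∷ (B , N) ∷ rest)) pr (no ¬sM) =
    f∘g-join m p us A M B N rest ¬sM pr prJ (FirstIsS? (joinChain p us (A , M) (B , N) rest) prJ)
    where
    prJ : IsXRChain ℛ _ (suc (suc (m + m))) (joinChain p us (A , M) (B , N) rest)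
    prJ = subst (λ k → IsXRChain ℛ _ k (joinChain p us (A , M) (B , N) rest)) (index-after-join m)
                (Join.isXRChain p us rest pr)

  f∘g : ∀ {n} (y : RHS ℛ n) → ChainEq (rawR ℛ (f (g y))) (rawR ℛ y)
  f∘g (m , ch , pr) = f∘g-chain m ch pr (FirstIsS? ch pr)

  f-split-natural : ∀ {n} (σ : Permutation′ n) m (ch : Chain n) pr s m′ (ch′ : Chain n) pr′ s′ →
    ChainEq ch′ (actChain σ ch) → ChainEq (rawR ℛ (f-split m′ ch′ pr′ s′)) (actChain σ (rawR ℛ (f-split m ch pr s)))
  f-split-natural σ m (chain us []) (_ , () , _) s m′ ch′ pr′ s′ eq
  f-split-natural σ m (chain us (_ ∷ _)) (_ , _ , _ , _ ∷ _) s m′ (chain us′ []) (_ , () , _) s′ eq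
  f-split-natural σ m (chain us ((U , R) ∷ rest)) (_ , _ , _ , r ∷ _) s m′ (chain us′ ((U′ , R′) ∷ rest′))
    (_ , _ , _ , r′ ∷ _) s′ (us-eq , (U-eq , R-eq) ∷ rest-eq) =
    canonicalChain-natural σ (network r) (network r′) (canonical-split (network r) s) (canonical-split (network r′) s′)
      us-eq U-eq R-eq rest-eq

  g-split-natural : ∀ {n} (σ : Permutation′ n) m (ch : Chain n) pr s m′ (ch′ : Chain n) pr′ s′ →
    ChainEq ch′ (actChain σ ch) → RawLEq (rawL ℛ (g-split m′ ch′ pr′ s′)) (actRawL σ (rawL ℛ (g-split m ch pr s)))
  g-split-natural σ m (chain us []) (_ , () , _) s m′ ch′ pr′ s′ eq
  g-split-natural σ m (chain us (_ ∷ _)) (_ , _ , _ , _ ∷ _) s m′ (chain us′ []) (_ , () , _) s′ eq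
  g-split-natural σ m (chain us ((U , R) ∷ rest)) (_ , _ , _ , r ∷ _) s m′ (chain us′ ((U′ , R′) ∷ rest′))
    (_ , _ , _ , r′ ∷ _) s′ (us-eq , (U-eq , R-eq) ∷ rest-eq) =
    canonicalChain-natural σ (network r) (network r′) (canonical-split (network r) s) (canonical-split (network r′) s′)
      us-eq U-eq R-eq rest-eq

  f-join-natural : ∀ {n} (σ : Permutation′ n) m (ch : Chain n) pr m′ (ch′ : Chain n) pr′ →
    ChainEq ch′ (actChain σ ch) → ChainEq (rawR ℛ (f-join m′ ch′ pr′)) (actChain σ (rawR ℛ (f-join m ch pr)))
  f-join-natural σ m (chain us []) (_ , () , _) m′ ch′ pr′ eq
  f-join-natural σ m (chain [] (_ ∷ _)) (() , _) m′ ch′ pr′ eq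
  f-join-natural σ m (chain (_ ∷ _) (_ ∷ [])) (_ , () , _) m′ ch′ pr′ eq
  f-join-natural σ m (chain (_ ∷ _) (_ ∷ _ ∷ _)) pr m′ (chain us′ []) (_ , () , _) eq
  f-join-natural σ m (chain (_ ∷ _) (_ ∷ _ ∷ _)) pr m′ (chain [] (_ ∷ _)) (() , _) eq
  f-join-natural σ m (chain (_ ∷ _) (_ ∷ _ ∷ _)) pr m′ (chain (_ ∷ _) (_ ∷ [])) (_ , () , _) eq
  f-join-natural σ m (chain (p ∷ us) ((A , M) ∷ (B , N) ∷ rest)) pr m′ (chain (p′ ∷ us′) ((A′ , M′) ∷ (B′ , N′) ∷ rest′)) pr′
    (p∷us-eq , (A-eq , M-eq) ∷ (B-eq , N-eq) ∷ rest-eq) =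
    joinChain-natural σ {p} {p′} {us} {us′} {A} {M} {B} {N} {A′} {M′} {B′} {N′} {rest} {rest′} (proj₁ (LP.∷-injective p∷us-eq)) (proj₂ (LP.∷-injective p∷us-eq)) A-eq M-eq B-eq N-eq rest-eq

  g-join-natural : ∀ {n} (σ : Permutation′ n) m (ch : Chain n) pr m′ (ch′ : Chain n) pr′ →
    ChainEq ch′ (actChain σ ch) → RawLEq (rawL ℛ (g-join m′ ch′ pr′)) (actRawL σ (rawL ℛ (g-join m ch pr)))
  g-join-natural σ m (chain us []) (_ , () , _) m′ ch′ pr′ eq
  g-join-natural σ m (chain [] (_ ∷ _)) (() , _) m′ ch′ pr′ eq
  g-join-natural σ m (chain (_ ∷ _) (_ ∷ [])) (_ , () , _) m′ ch′ pr′ eq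
  g-join-natural σ m (chain (_ ∷ _) (_ ∷ _ ∷ _)) pr m′ (chain us′ []) (_ , () , _) eq
  g-join-natural σ m (chain (_ ∷ _) (_ ∷ _ ∷ _)) pr m′ (chain [] (_ ∷ _)) (() , _) eq
  g-join-natural σ m (chain (_ ∷ _) (_ ∷ _ ∷ _)) pr m′ (chain (_ ∷ _) (_ ∷ [])) (_ , () , _) eq
  g-join-natural σ zero (chain (p ∷ []) ((A , M) ∷ (B , N) ∷ [])) pr zero (chain (p′ ∷ []) ((A′ , M′) ∷ (B′ , N′) ∷ [])) pr′
    (p∷[]-eq , (_ , M-eq) ∷ (_ , N-eq) ∷ []) =
    subst (λ q → GraphEq (seriesGraph q M′ N′) (actGraph σ (seriesGraph p M N))) (sym (proj₁ (LP.∷-injective p∷[]-eq)))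
      (seriesGraph-act σ p {M} {N} {M′} {N′} M-eq N-eq)
  g-join-natural σ zero (chain (p ∷ []) (_ ∷ _ ∷ _ ∷ _)) (_ , () , _) m′ ch′ pr′ eq
  g-join-natural σ zero (chain (p ∷ _ ∷ _) (_ ∷ _ ∷ _)) (() , _) m′ ch′ pr′ eq
  g-join-natural σ zero (chain (p ∷ []) (_ ∷ _ ∷ [])) pr zero (chain (p′ ∷ []) (_ ∷ _ ∷ _ ∷ _)) (_ , () , _) eq
  g-join-natural σ zero (chain (p ∷ []) (_ ∷ _ ∷ [])) pr zero (chain (p′ ∷ _ ∷ _) (_ ∷ _ ∷ _)) (() , _) eq
  g-join-natural σ zero (chain (p ∷ []) (_ ∷ _ ∷ [])) pr (suc m′) (chain (p′ ∷ us′) (_ ∷ _ ∷ [])) (_ , () , _) eq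
  g-join-natural σ zero (chain (p ∷ []) (_ ∷ _ ∷ [])) pr (suc m′) (chain (p′ ∷ us′) (_ ∷ _ ∷ _ ∷ _)) pr′ (_ , _ ∷ _ ∷ ())
  g-join-natural σ (suc m) (chain (p ∷ us) (_ ∷ _ ∷ [])) (_ , () , _) m′ ch′ pr′ eq
  g-join-natural σ (suc m) (chain (p ∷ us) (_ ∷ _ ∷ _ ∷ _)) pr zero (chain (p′ ∷ []) (_ ∷ _ ∷ [])) pr′ (_ , _ ∷ _ ∷ ())
  g-join-natural σ (suc m) (chain (p ∷ us) (_ ∷ _ ∷ _ ∷ _)) pr zero (chain (p′ ∷ []) (_ ∷ _ ∷ _ ∷ _)) (_ , () , _) eq
  g-join-natural σ (suc m) (chain (p ∷ us) (_ ∷ _ ∷ _ ∷ _)) pr zero (chain (p′ ∷ _ ∷ _) (_ ∷ _ ∷ _)) (() , _) eq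
  g-join-natural σ (suc m) (chain (p ∷ us) ((A , M) ∷ (B , N) ∷ rest@(_ ∷ _))) pr (suc m′)
    (chain (p′ ∷ us′) ((A′ , M′) ∷ (B′ , N′) ∷ rest′)) pr′ (p∷us-eq , (A-eq , M-eq) ∷ (B-eq , N-eq) ∷ rest-eq) =
    joinChain-natural σ {p} {p′} {us} {us′} {A} {M} {B} {N} {A′} {M′} {B′} {N′} {rest} {rest′} (proj₁ (LP.∷-injective p∷us-eq)) (proj₂ (LP.∷-injective p∷us-eq)) A-eq M-eq B-eq N-eq rest-eq

  f-chain-natural : ∀ {n} (σ : Permutation′ n) m (ch : Chain n) pr (d : Dec (FirstIsS ch))
    m′ (ch′ : Chain n) pr′ (d′ : Dec (FirstIsS ch′)) →
    ChainEq ch′ (actChain σ ch) → ChainEq (rawR ℛ (f-chain m′ ch′ pr′ d′)) (actChain σ (rawR ℛ (f-chain m ch pr d)))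
  f-chain-natural σ m ch pr (yes s) m′ ch′ pr′ (yes s′) eq = f-split-natural σ m ch pr s m′ ch′ pr′ s′ eq
  f-chain-natural σ m ch pr (yes s) m′ ch′ pr′ (no ¬s′) eq =
    ⊥-elim (¬s′ (Equivalence.to (FirstIsS-relabel σ ch pr ch′ pr′ eq) s))
  f-chain-natural σ m ch pr (no ¬s) m′ ch′ pr′ (yes s′) eq =
    ⊥-elim (¬s (Equivalence.from (FirstIsS-relabel σ ch pr ch′ pr′ eq) s′))
  f-chain-natural σ m ch pr (no _) m′ ch′ pr′ (no _) eq = f-join-natural σ m ch pr m′ ch′ pr′ eq

  g-chain-natural : ∀ {n} (σ : Permutation′ n) m (ch : Chain n) pr (d : Dec (FirstIsS ch))
    m′ (ch′ : Chain n) pr′ (d′ : Dec (FirstIsS ch′)) →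
    ChainEq ch′ (actChain σ ch) → RawLEq (rawL ℛ (g-chain m′ ch′ pr′ d′)) (actRawL σ (rawL ℛ (g-chain m ch pr d)))
  g-chain-natural σ m ch pr (yes s) m′ ch′ pr′ (yes s′) eq = g-split-natural σ m ch pr s m′ ch′ pr′ s′ eq
  g-chain-natural σ m ch pr (yes s) m′ ch′ pr′ (no ¬s′) eq =
    ⊥-elim (¬s′ (Equivalence.to (FirstIsS-relabel σ ch pr ch′ pr′ eq) s))
  g-chain-natural σ m ch pr (no ¬s) m′ ch′ pr′ (yes s′) eq =
    ⊥-elim (¬s (Equivalence.from (FirstIsS-relabel σ ch pr ch′ pr′ eq) s′))
  g-chain-natural σ m ch pr (no _) m′ ch′ pr′ (no _) eq = g-join-natural σ m ch pr m′ ch′ pr′ eq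

  f-natural : ∀ {n} (σ : Permutation′ n) (x x′ : LHS ℛ n) → RawLEq (rawL ℛ x′) (actRawL σ (rawL ℛ x)) →
    ChainEq (rawR ℛ (f x′)) (actChain σ (rawR ℛ (f x)))
  f-natural σ (inj₁ (G , r , s)) (inj₁ (G′ , r′ , s′)) eq =
    canonicalChain-natural σ (network r) (network r′) (canonical-split (network r) s) (canonical-split (network r′) s′)
      refl (full-act σ) eq []
  f-natural σ (inj₂ (m , ch , pr)) (inj₂ (m′ , ch′ , pr′)) eq =
    f-chain-natural σ m ch pr (FirstIsS? ch pr) m′ ch′ pr′ (FirstIsS? ch′ pr′) eq

  g-natural : ∀ {n} (σ : Permutation′ n) (y y′ : RHS ℛ n) → ChainEq (rawR ℛ y′) (actChain σ (rawR ℛ y)) →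
    RawLEq (rawL ℛ (g y′)) (actRawL σ (rawL ℛ (g y)))
  g-natural σ (m , ch , pr) (m′ , ch′ , pr′) eq =
    g-chain-natural σ m ch pr (FirstIsS? ch pr) m′ ch′ pr′ (FirstIsS? ch′ pr′) eq

  -- Compatibility with equality of structures is naturality along the identity permutation.
  f-cong : ∀ {n} (x y : LHS ℛ n) → RawLEq (rawL ℛ x) (rawL ℛ y) → ChainEq (rawR ℛ (f x)) (rawR ℛ (f y))
  f-cong x y eq = ChainEq-trans (f-natural P.id y x (RawLEq-trans {x = rawL ℛ x} eq (actRawL-id (rawL ℛ y))))
                                (ChainEq-sym (actChain-id (rawR ℛ (f y))))

  g-cong : ∀ {n} (x y : RHS ℛ n) → ChainEq (rawR ℛ x) (rawR ℛ y) → RawLEq (rawL ℛ (g x)) (rawL ℛ (g y))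
  g-cong x y eq = RawLEq-trans {x = rawL ℛ (g x)} (g-natural P.id y x (ChainEq-trans eq (actChain-id (rawR ℛ y))))
                               (RawLEq-sym {x = rawL ℛ (g y)} (actRawL-id (rawL ℛ (g y))))

  natIso : NatIso ℛ
  natIso = record
    { f = f ; g = g ; f-cong = f-cong ; g-cong = g-cong ; gf = g∘f ; fg = f∘g ; natural = f-natural }

proposition1 : (ℛ : NetSpecies) →
    IsSpeciesOfNonTrivialNetworks ℛ →
    ClosedUnderSeries ℛ →
    (∀ n G → SNets ℛ n full G ⇔ InSeriesProduct (Minus ℛ (SNets ℛ)) ℛ n full G) ×
    IsCanonical (Minus ℛ (SNets ℛ)) ℛ ×
    NatIso ℛ
proposition1 ℛ species closed = sNetwork⇔seriesProduct , seriesProduct-canonical , natIso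
  where open ClosedSpecies ℛ species closed
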